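{- For all integers $n,k\ge1$, \begin{align*} \widehat{D}_{2n}^{(-k)}&=\sum_{j=0}^{\min\{2n,k-1\}}\frac{j!(j+1)!}{2^{j+1}}\left\{{2n\atop j}\right\}\left\{{k\atop j+1}\right\} +\sum_{j=0}^{\min\{2n-1,k-1\}}\frac{((j+1)!)^2}{2^{j+1}}\left\{{2n\atop j+1}\right\}\left\{{k\atop j+1}\right\}\\ &\quad+\sum_{j=0}^{\min\{2n-1,k-1\}}\frac{(j+1)!(j+2)!}{2^{j+1}}\left\{{2n\atop j+2}\right\}\left\{{k\atop j+1}\right\} +\sum_{j=0}^{\min\{2n,k-1\}}\frac{j!(j+1)!}{2^{j+1}}\left\{{2n+1\atop j+1}\right\}\left\{{k\atop j+1}\right\}. \end{align*}
   Context: For $k\in\mathbb{Z}$ and $|z|<1$, let $\mathrm{Li}_k(z)=\sum_{n\ge1}z^n/n^k$ and $\mathrm{A}_k(z)=\mathrm{Li}_k(z)-\mathrm{Li}_k(-z)$. The polycotangent numbers $\widehat{D}_n^{(k)}$ are defined by \[ \frac{\mathrm{A}_k(\tanh(t/2))}{\tanh t}=\sum_{n\ge0}\widehat{D}_n^{(k)}\frac{t^n}{n!}. \] The Stirling numbers of the second kind $\left\{{n\atop m}\right\}$ are given by $\left\{{0\atop 0}\right\}=1$, $\left\{{n\atop 0}\right\}=\left\{{0\atop m}\right\}=0$ for $n,m\ne0$, and $\left\{{n\atop m}\right\}=\left\{{n-1\atop m-1}\right\}+m\left\{{n-1\atop m}\right\}$. -}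

module Defs where

open import Data.Nat as ℕ using (ℕ; zero; suc; _∸_; _⊓_; _!)
open import Data.Integer as ℤ using (ℤ; +_; -[1+_])
open import Data.Rational as ℚ using (ℚ; 0ℚ; 1ℚ; _+_; _*_; -_; 1/_; _/_)
open import Relation.Nullary using (yes; no)

sumTo : ℕ → (ℕ → ℚ) → ℚ
sumTo zero    f = f 0
sumTo (suc n) f = sumTo n f + f (suc n)

fromℕ : ℕ → ℚ
fromℕ n = + n / 1

invFact : ℕ → ℚ
invFact zero    = 1ℚ
invFact (suc n) = invFact n * (+ 1 / suc n)

invPow2 : ℕ → ℚ
invPow2 zero    = 1ℚ
invPow2 (suc m) = invPow2 m * (+ 1 / 2)

qpow : ℚ → ℕ → ℚ
qpow q zero    = 1ℚ
qpow q (suc m) = qpow q m * q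

-- reciprocal, with the (never used) convention 1/0 := 0
recip : ℚ → ℚ
recip q with q ℚ.≟ 0ℚ
... | yes _  = 0ℚ
... | no q≢0 = (1/ q) {{ℚ.≢-nonZero q≢0}}

-- Formal power series over ℚ  (f n = coefficient of t^n)

Series : Set
Series = ℕ → ℚ

_⊕_ : Series → Series → Series
(f ⊕ g) n = f n + g n

⊖_ : Series → Series
(⊖ f) n = - f n

_⊛_ : Series → Series → Series
(f ⊛ g) n = sumTo n (λ i → f i * g (n ∸ i))

constS : ℚ → Series
constS c zero    = c
constS c (suc _) = 0ℚ

powS : Series → ℕ → Series
powS g zero    = constS 1ℚ
powS g (suc m) = powS g m ⊛ g

-- multiplicative inverse of a series with nonzero constant term:
-- b 0 = 1/a 0,  b n = -(1/a 0) Σ_{i=1}^{n} a i b (n-i)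
invUpTo : Series → ℕ → Series
invUpTo a zero    m = recip (a 0)
invUpTo a (suc n) m with m ℕ.≤? n
... | yes _ = invUpTo a n m
... | no  _ = - (recip (a 0) *
                 sumTo n (λ i → a (suc i) * invUpTo a n (n ∸ i)))

invS : Series → Series
invS a n = invUpTo a n n

-- composition f(g(t)) for g with zero constant term
_∘S_ : Series → Series → Series
(f ∘S g) n = sumTo n (λ m → f m * powS g m n)

-- f(t)/t  (for f with zero constant term)
divT : Series → Series
divT f n = f (suc n)

expS : ℚ → Series
expS c n = qpow c n * invFact n

-- tanh(t/2) = (e^t - 1)/(e^t + 1)
tanhHalfS : Series
tanhHalfS = (expS 1ℚ ⊕ (⊖ constS 1ℚ)) ⊛ invS (expS 1ℚ ⊕ constS 1ℚ)

-- tanh t = (e^{2t} - 1)/(e^{2t} + 1)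
tanhS : Series
tanhS = (expS (+ 2 / 1) ⊕ (⊖ constS 1ℚ)) ⊛ invS (expS (+ 2 / 1) ⊕ constS 1ℚ)

npowNeg : ℕ → ℤ → ℚ
npowNeg n (+ m)      = recip (fromℕ (n ℕ.^ m))
npowNeg n -[1+ m ]   = fromℕ (n ℕ.^ suc m)

LiS : ℤ → Series
LiS k zero    = 0ℚ
LiS k (suc n) = npowNeg (suc n) k

-- A_k(z) = Li_k(z) - Li_k(-z);  coefficient (1 - (-1)^n) n^{-k}
AS : ℤ → Series
AS k n = LiS k n + (- (qpow (- 1ℚ) n * LiS k n))

-- polycotangent numbers:  A_k(tanh(t/2)) / tanh t = Σ D̂_n^{(k)} t^n / n!
polycotD : ℤ → ℕ → ℚ
polycotD k n =
  fromℕ (n !) * ((divT (AS k ∘S tanhHalfS) ⊛ invS (divT tanhS)) n)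

stirling2 : ℕ → ℕ → ℕ
stirling2 zero    zero    = 1
stirling2 zero    (suc m) = 0
stirling2 (suc n) zero    = 0
stirling2 (suc n) (suc m) = stirling2 n m ℕ.+ suc m ℕ.* stirling2 n (suc m)

module Submission where

-- Work in ℚ[[t]] with u = eᵗ − 1 and P = eᵗ + 1. Since tanh(t/2) = u/P and 1 − tanh(t/2) = 2/P, the
-- binomial series Σₘ (m choose j) xᵐ = xʲ/(1 − x)ʲ⁺¹ at x = tanh(t/2) equals uʲP/2ʲ⁺¹, so expanding
-- mᵏ = Σⱼ S(k, j) j! (m choose j) gives Li₋ₖ(tanh(t/2)) = Σⱼ S(k, j) j! uʲP/2ʲ⁺¹. As uP = e²ᵗ − 1
-- = tanh t · (e²ᵗ + 1), this is tanh t · H(t) with H = Σⱼ S(k, j + 1) (j + 1)! uʲ (e²ᵗ + 1)/2ʲ⁺².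
-- Both tanh(t/2) and tanh t are odd, hence A₋ₖ(tanh(t/2))/tanh t = H(t) + H(−t), whose coefficient
-- of t²ⁿ is twice that of H. Finally e²ᵗ + 1 = u² + 2u + 2 and n! [tⁿ] uᵖ = p! S(n, p), which
-- follows from the power rule and u′ = 1 + u, turn 2 (2n)! [t²ⁿ] H into the four Stirling sums.
-- Identities between exponentials are obtained from uniqueness of solutions of f′ = c f.

module Polycotangent where
  open import Defs
  open import Data.Nat as ℕ using (ℕ; zero; suc; _∸_; _⊓_; _!; _≤_; _<_; z≤n; s≤s)
  import Data.Nat.Properties as ℕP
  open import Data.Integer as ℤ using ()
  import Data.Integer.Properties as ℤP
  open import Data.Rational as ℚ using (ℚ; mkℚ; 0ℚ; 1ℚ; _+_; _*_; -_; _/_)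
  import Data.Rational.Properties as ℚP
  open import Data.Rational.Solver using (module +-*-Solver)
  open +-*-Solver
  open import Data.Nat.Coprimality as Coprime using ()
  open import Data.Sum using (inj₁; inj₂)
  open import Data.Empty using (⊥-elim)
  open import Data.Nat.Tactic.RingSolver using (solve-∀)
  open import Data.Nat.Combinatorics using (_C_; nCk+nC[k+1]≡[n+1]C[k+1]; nC1≡n)
  open import Relation.Nullary using (yes; no)
  open import Relation.Binary.PropositionalEquality
  import Relation.Binary.Reasoning.Setoid as SetoidReasoning

  sumTo-cong : ∀ n {f g : ℕ → ℚ} → (∀ i → i ≤ n → f i ≡ g i) → sumTo n f ≡ sumTo n g
  sumTo-cong zero    f≡g = f≡g 0 z≤n
  sumTo-cong (suc n) f≡g =
    cong₂ _+_ (sumTo-cong n (λ i i≤n → f≡g i (ℕP.m≤n⇒m≤1+n i≤n))) (f≡g (suc n) ℕP.≤-refl)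

  sumTo-congʳ : ∀ n {f g : ℕ → ℚ} → f ≗ g → sumTo n f ≡ sumTo n g
  sumTo-congʳ n f≗g = sumTo-cong n (λ i _ → f≗g i)

  sumTo-zero : ∀ n {f : ℕ → ℚ} → (∀ i → i ≤ n → f i ≡ 0ℚ) → sumTo n f ≡ 0ℚ
  sumTo-zero zero    f≡0 = f≡0 0 z≤n
  sumTo-zero (suc n) f≡0 =
    cong₂ _+_ (sumTo-zero n (λ i i≤n → f≡0 i (ℕP.m≤n⇒m≤1+n i≤n))) (f≡0 (suc n) ℕP.≤-refl)

  sumTo-+ : ∀ n (f g : ℕ → ℚ) → sumTo n (λ i → f i + g i) ≡ sumTo n f + sumTo n g
  sumTo-+ zero    f g = refl
  sumTo-+ (suc n) f g = begin
    sumTo n (λ i → f i + g i) + (f (suc n) + g (suc n))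
      ≡⟨ cong (_+ (f (suc n) + g (suc n))) (sumTo-+ n f g) ⟩
    (sumTo n f + sumTo n g) + (f (suc n) + g (suc n))
      ≡⟨ ℚP.+-assoc (sumTo n f) (sumTo n g) _ ⟩
    sumTo n f + (sumTo n g + (f (suc n) + g (suc n)))
      ≡⟨ cong (sumTo n f +_) (ℚP.+-comm (sumTo n g) _) ⟩
    sumTo n f + ((f (suc n) + g (suc n)) + sumTo n g)
      ≡⟨ cong (sumTo n f +_) (ℚP.+-assoc (f (suc n)) (g (suc n)) (sumTo n g)) ⟩
    sumTo n f + (f (suc n) + (g (suc n) + sumTo n g))
      ≡⟨ cong (λ x → sumTo n f + (f (suc n) + x)) (ℚP.+-comm (g (suc n)) (sumTo n g)) ⟩
    sumTo n f + (f (suc n) + sumTo (suc n) g)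
      ≡⟨ ℚP.+-assoc (sumTo n f) (f (suc n)) (sumTo (suc n) g) ⟨
    sumTo (suc n) f + sumTo (suc n) g ∎
    where open ≡-Reasoning

  *-distribˡ-sumTo : ∀ n c (f : ℕ → ℚ) → c * sumTo n f ≡ sumTo n (λ i → c * f i)
  *-distribˡ-sumTo zero    c f = refl
  *-distribˡ-sumTo (suc n) c f =
    trans (ℚP.*-distribˡ-+ c (sumTo n f) (f (suc n))) (cong (_+ c * f (suc n)) (*-distribˡ-sumTo n c f))

  *-distribʳ-sumTo : ∀ n c (f : ℕ → ℚ) → sumTo n f * c ≡ sumTo n (λ i → f i * c)
  *-distribʳ-sumTo n c f = begin
    sumTo n f * c             ≡⟨ ℚP.*-comm (sumTo n f) c ⟩
    c * sumTo n f             ≡⟨ *-distribˡ-sumTo n c f ⟩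
    sumTo n (λ i → c * f i)   ≡⟨ sumTo-congʳ n (λ i → ℚP.*-comm c (f i)) ⟩
    sumTo n (λ i → f i * c)   ∎
    where open ≡-Reasoning

  neg-distrib-sumTo : ∀ n (f : ℕ → ℚ) → - sumTo n f ≡ sumTo n (λ i → - f i)
  neg-distrib-sumTo zero    f = refl
  neg-distrib-sumTo (suc n) f =
    trans (ℚP.neg-distrib-+ (sumTo n f) (f (suc n))) (cong (_+ - f (suc n)) (neg-distrib-sumTo n f))

  sumTo-suc : ∀ n (f : ℕ → ℚ) → sumTo (suc n) f ≡ f 0 + sumTo n (λ i → f (suc i))
  sumTo-suc zero    f = refl
  sumTo-suc (suc n) f = trans (cong (_+ f (suc (suc n))) (sumTo-suc n f))
    (ℚP.+-assoc (f 0) (sumTo n (λ i → f (suc i))) (f (suc (suc n))))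

  sumTo-suc-vanishing : ∀ n (f : ℕ → ℚ) → f 0 ≡ 0ℚ → sumTo (suc n) f ≡ sumTo n (λ i → f (suc i))
  sumTo-suc-vanishing n f f0≡0 = begin
    sumTo (suc n) f                      ≡⟨ sumTo-suc n f ⟩
    f 0 + sumTo n (λ i → f (suc i))      ≡⟨ cong (_+ sumTo n (λ i → f (suc i))) f0≡0 ⟩
    0ℚ + sumTo n (λ i → f (suc i))       ≡⟨ ℚP.+-identityˡ _ ⟩
    sumTo n (λ i → f (suc i))            ∎
    where open ≡-Reasoning

  sumTo-extend : ∀ {m n} (f : ℕ → ℚ) → m ≤ n → (∀ i → m < i → f i ≡ 0ℚ) → sumTo m f ≡ sumTo n f
  sumTo-extend {m} {zero}  f z≤n _ = refl
  sumTo-extend {m} {suc n} f m≤1+n f≡0 with ℕP.m≤n⇒m<n∨m≡n m≤1+n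
  ... | inj₂ refl = refl
  ... | inj₁ (s≤s m≤n) = begin
    sumTo m f                ≡⟨ sumTo-extend f m≤n f≡0 ⟩
    sumTo n f                ≡⟨ ℚP.+-identityʳ (sumTo n f) ⟨
    sumTo n f + 0ℚ           ≡⟨ cong (sumTo n f +_) (f≡0 (suc n) (s≤s m≤n)) ⟨
    sumTo (suc n) f          ∎
    where open ≡-Reasoning

  sumTo-⊓ : ∀ m n (f : ℕ → ℚ) → (∀ i → m < i → f i ≡ 0ℚ) → sumTo (m ⊓ n) f ≡ sumTo n f
  sumTo-⊓ m n f f≡0 with ℕP.≤-total m n
  ... | inj₁ m≤n = trans (cong (λ l → sumTo l f) (ℕP.m≤n⇒m⊓n≡m m≤n)) (sumTo-extend f m≤n f≡0)
  ... | inj₂ n≤m = cong (λ l → sumTo l f) (ℕP.m≥n⇒m⊓n≡n n≤m)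

  sumTo-+₄ : ∀ n (f g h l : ℕ → ℚ) →
    sumTo n (λ i → f i + g i + h i + l i) ≡ sumTo n f + sumTo n g + sumTo n h + sumTo n l
  sumTo-+₄ n f g h l = trans (sumTo-+ n (λ i → f i + g i + h i) l)
    (cong (_+ sumTo n l) (trans (sumTo-+ n (λ i → f i + g i) h) (cong (_+ sumTo n h) (sumTo-+ n f g))))

  m∸1<n⇒m<1+n : ∀ m {n} → m ∸ 1 < n → m < suc n
  m∸1<n⇒m<1+n m m∸1<n = ℕP.≤-<-trans (ℕP.m≤n+m∸n m 1) (s≤s m∸1<n)

  sumTo-comm : ∀ m n (F : ℕ → ℕ → ℚ) →
    sumTo m (λ i → sumTo n (F i)) ≡ sumTo n (λ j → sumTo m (λ i → F i j))
  sumTo-comm zero    n F = refl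
  sumTo-comm (suc m) n F = begin
    sumTo m (λ i → sumTo n (F i)) + sumTo n (F (suc m))
      ≡⟨ cong (_+ sumTo n (F (suc m))) (sumTo-comm m n F) ⟩
    sumTo n (λ j → sumTo m (λ i → F i j)) + sumTo n (F (suc m))
      ≡⟨ sumTo-+ n (λ j → sumTo m (λ i → F i j)) (F (suc m)) ⟨
    sumTo n (λ j → sumTo (suc m) (λ i → F i j)) ∎
    where open ≡-Reasoning

  sumTo-reverse : ∀ n (f : ℕ → ℚ) → sumTo n f ≡ sumTo n (λ i → f (n ∸ i))
  sumTo-reverse zero    f = refl
  sumTo-reverse (suc n) f = begin
    sumTo n f + f (suc n)                   ≡⟨ ℚP.+-comm (sumTo n f) (f (suc n)) ⟩
    f (suc n) + sumTo n f                   ≡⟨ cong (f (suc n) +_) (sumTo-reverse n f) ⟩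
    f (suc n) + sumTo n (λ i → f (n ∸ i))   ≡⟨ sumTo-suc n (λ i → f (suc n ∸ i)) ⟨
    sumTo (suc n) (λ i → f (suc n ∸ i))     ∎
    where open ≡-Reasoning

  sumTo-reverse₂ : ∀ n (F : ℕ → ℕ → ℚ) → sumTo n (λ i → F i (n ∸ i)) ≡ sumTo n (λ i → F (n ∸ i) i)
  sumTo-reverse₂ n F = trans (sumTo-reverse n (λ i → F i (n ∸ i)))
    (sumTo-cong n (λ i i≤n → cong (F (n ∸ i)) (ℕP.m∸[m∸n]≡n i≤n)))

  sumTo-triangle : ∀ n (F : ℕ → ℕ → ℚ) →
    sumTo n (λ i → sumTo i (F i)) ≡ sumTo n (λ j → sumTo (n ∸ j) (λ k → F (j ℕ.+ k) j))
  sumTo-triangle zero    F = refl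
  sumTo-triangle (suc n) F = begin
    sumTo n (λ i → sumTo i (F i)) + (sumTo n (F (suc n)) + F (suc n) (suc n))
      ≡⟨ cong (_+ (sumTo n (F (suc n)) + F (suc n) (suc n))) (sumTo-triangle n F) ⟩
    Rows + (sumTo n (F (suc n)) + F (suc n) (suc n))
      ≡⟨ ℚP.+-assoc (Rows) (sumTo n (F (suc n))) (F (suc n) (suc n)) ⟨
    (Rows + sumTo n (F (suc n))) + F (suc n) (suc n)
      ≡⟨ cong₂ _+_ (trans (sym (sumTo-+ n _ (F (suc n)))) (sumTo-cong n extend-row)) corner ⟩
    sumTo n (λ j → sumTo (suc n ∸ j) (λ k → F (j ℕ.+ k) j)) + sumTo (suc n ∸ suc n) (λ k → F (suc n ℕ.+ k) (suc n)) ∎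
    where
    open ≡-Reasoning
    Rows : ℚ
    Rows = sumTo n (λ j → sumTo (n ∸ j) (λ k → F (j ℕ.+ k) j))
    extend-row : ∀ j → j ≤ n →
      sumTo (n ∸ j) (λ k → F (j ℕ.+ k) j) + F (suc n) j ≡ sumTo (suc n ∸ j) (λ k → F (j ℕ.+ k) j)
    extend-row j j≤n rewrite ℕP.+-∸-assoc 1 j≤n =
      cong (λ m → sumTo (n ∸ j) (λ k → F (j ℕ.+ k) j) + F m j)
        (trans (sym (ℕP.m+[n∸m]≡n (ℕP.m≤n⇒m≤1+n j≤n))) (cong (j ℕ.+_) (ℕP.+-∸-assoc 1 j≤n)))
    corner : F (suc n) (suc n) ≡ sumTo (suc n ∸ suc n) (λ k → F (suc n ℕ.+ k) (suc n))
    corner rewrite ℕP.n∸n≡0 n | ℕP.+-identityʳ n = refl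

  fromℕ≡mkℚ : ∀ n → fromℕ n ≡ mkℚ (ℤ.+ n) 0 (Coprime.sym (Coprime.1-coprimeTo n))
  fromℕ≡mkℚ n = ℚP.↥p/↧p≡p (mkℚ (ℤ.+ n) 0 (Coprime.sym (Coprime.1-coprimeTo n)))

  fromℕ-+ : ∀ m n → fromℕ (m ℕ.+ n) ≡ fromℕ m + fromℕ n
  fromℕ-+ m n rewrite fromℕ≡mkℚ m | fromℕ≡mkℚ n =
    ℚP./-cong (sym (cong₂ ℤ._+_ (ℤP.*-identityʳ (ℤ.+ m)) (ℤP.*-identityʳ (ℤ.+ n)))) refl

  fromℕ-* : ∀ m n → fromℕ (m ℕ.* n) ≡ fromℕ m * fromℕ n
  fromℕ-* m n rewrite fromℕ≡mkℚ m | fromℕ≡mkℚ n = ℚP./-cong (ℤP.pos-* m n) refl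

  fromℕ-*-inverse : ∀ n → fromℕ (suc n) * (ℤ.+ 1 / suc n) ≡ 1ℚ
  fromℕ-*-inverse n rewrite fromℕ≡mkℚ (suc n) | ℚP.↥p/↧p≡p (mkℚ (ℤ.+ 1) n (Coprime.1-coprimeTo (suc n))) =
    ℚP.*-inverseʳ (mkℚ (ℤ.+ suc n) 0 (Coprime.sym (Coprime.1-coprimeTo (suc n))))

  -- Formal power series

  module ≗-Reasoning = SetoidReasoning (ℕ →-setoid ℚ)

  𝟙 : Series
  𝟙 = constS 1ℚ

  scale : ℚ → Series → Series
  scale c f n = c * f n

  ⊕-cong : ∀ {f f′ g g′} → f ≗ f′ → g ≗ g′ → f ⊕ g ≗ f′ ⊕ g′
  ⊕-cong f≗f′ g≗g′ n = cong₂ _+_ (f≗f′ n) (g≗g′ n)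

  ⊕-congˡ : ∀ f {g g′} → g ≗ g′ → f ⊕ g ≗ f ⊕ g′
  ⊕-congˡ f = ⊕-cong {f} (λ _ → refl)

  ⊖-cong : ∀ {f g} → f ≗ g → ⊖ f ≗ ⊖ g
  ⊖-cong f≗g n = cong -_ (f≗g n)

  ⊛-cong : ∀ {f f′ g g′} → f ≗ f′ → g ≗ g′ → f ⊛ g ≗ f′ ⊛ g′
  ⊛-cong f≗f′ g≗g′ n = sumTo-congʳ n (λ i → cong₂ _*_ (f≗f′ i) (g≗g′ (n ∸ i)))

  ⊛-congˡ : ∀ f {g g′} → g ≗ g′ → f ⊛ g ≗ f ⊛ g′
  ⊛-congˡ f = ⊛-cong {f} (λ _ → refl)

  ⊛-congʳ : ∀ {f f′} g → f ≗ f′ → f ⊛ g ≗ f′ ⊛ g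
  ⊛-congʳ g f≗f′ = ⊛-cong {g = g} f≗f′ (λ _ → refl)

  ⊛-comm : ∀ f g → f ⊛ g ≗ g ⊛ f
  ⊛-comm f g n = trans (sumTo-reverse₂ n (λ i j → f i * g j))
    (sumTo-congʳ n (λ i → ℚP.*-comm (f (n ∸ i)) (g i)))

  ⊛-assoc : ∀ f g h → (f ⊛ g) ⊛ h ≗ f ⊛ (g ⊛ h)
  ⊛-assoc f g h n = begin
    sumTo n (λ i → sumTo i (λ j → f j * g (i ∸ j)) * h (n ∸ i))
      ≡⟨ sumTo-congʳ n (λ i → *-distribʳ-sumTo i (h (n ∸ i)) (λ j → f j * g (i ∸ j))) ⟩
    sumTo n (λ i → sumTo i (λ j → f j * g (i ∸ j) * h (n ∸ i)))
      ≡⟨ sumTo-triangle n (λ i j → f j * g (i ∸ j) * h (n ∸ i)) ⟩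
    sumTo n (λ j → sumTo (n ∸ j) (λ k → f j * g ((j ℕ.+ k) ∸ j) * h (n ∸ (j ℕ.+ k))))
      ≡⟨ sumTo-congʳ n (λ j → trans (sumTo-congʳ (n ∸ j) (reindex j))
           (sym (*-distribˡ-sumTo (n ∸ j) (f j) (λ k → g k * h (n ∸ j ∸ k))))) ⟩
    sumTo n (λ j → f j * sumTo (n ∸ j) (λ k → g k * h (n ∸ j ∸ k))) ∎
    where
    open ≡-Reasoning
    reindex : ∀ j k → f j * g ((j ℕ.+ k) ∸ j) * h (n ∸ (j ℕ.+ k)) ≡ f j * (g k * h (n ∸ j ∸ k))
    reindex j k = trans (cong₂ (λ a b → f j * g a * h b) (ℕP.m+n∸m≡n j k) (sym (ℕP.∸-+-assoc n j k)))
                        (ℚP.*-assoc (f j) (g k) (h (n ∸ j ∸ k)))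

  ⊛-distribʳ-⊕ : ∀ h f g → (f ⊕ g) ⊛ h ≗ (f ⊛ h) ⊕ (g ⊛ h)
  ⊛-distribʳ-⊕ h f g n =
    trans (sumTo-congʳ n (λ i → ℚP.*-distribʳ-+ (h (n ∸ i)) (f i) (g i))) (sumTo-+ n _ _)

  ⊛-distribˡ-⊕ : ∀ h f g → h ⊛ (f ⊕ g) ≗ (h ⊛ f) ⊕ (h ⊛ g)
  ⊛-distribˡ-⊕ h f g n =
    trans (sumTo-congʳ n (λ i → ℚP.*-distribˡ-+ (h i) (f (n ∸ i)) (g (n ∸ i)))) (sumTo-+ n _ _)

  ⊛-scaleˡ : ∀ c f g → scale c f ⊛ g ≗ scale c (f ⊛ g)
  ⊛-scaleˡ c f g n = trans (sumTo-congʳ n (λ i → ℚP.*-assoc c (f i) (g (n ∸ i))))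
    (sym (*-distribˡ-sumTo n c (λ i → f i * g (n ∸ i))))

  ⊛-scaleʳ : ∀ c f g → f ⊛ scale c g ≗ scale c (f ⊛ g)
  ⊛-scaleʳ c f g n = begin
    (f ⊛ scale c g) n   ≡⟨ ⊛-comm f (scale c g) n ⟩
    (scale c g ⊛ f) n   ≡⟨ ⊛-scaleˡ c g f n ⟩
    c * (g ⊛ f) n       ≡⟨ cong (c *_) (⊛-comm g f n) ⟩
    c * (f ⊛ g) n       ∎
    where open ≡-Reasoning

  ⊛-negˡ : ∀ f g → (⊖ f) ⊛ g ≗ ⊖ (f ⊛ g)
  ⊛-negˡ f g n = trans (sumTo-congʳ n (λ i → sym (ℚP.neg-distribˡ-* (f i) (g (n ∸ i)))))
    (sym (neg-distrib-sumTo n (λ i → f i * g (n ∸ i))))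

  ⊛-negʳ : ∀ f g → f ⊛ (⊖ g) ≗ ⊖ (f ⊛ g)
  ⊛-negʳ f g n = trans (⊛-comm f (⊖ g) n) (trans (⊛-negˡ g f n) (cong -_ (⊛-comm g f n)))

  constS-⊛ : ∀ c f → constS c ⊛ f ≗ scale c f
  constS-⊛ c f zero    = refl
  constS-⊛ c f (suc n) = begin
    sumTo (suc n) (λ i → constS c i * f (suc n ∸ i))
      ≡⟨ sumTo-suc n (λ i → constS c i * f (suc n ∸ i)) ⟩
    c * f (suc n) + sumTo n (λ i → 0ℚ * f (n ∸ i))
      ≡⟨ cong (c * f (suc n) +_) (sumTo-zero n (λ i _ → ℚP.*-zeroˡ (f (n ∸ i)))) ⟩
    c * f (suc n) + 0ℚ
      ≡⟨ ℚP.+-identityʳ (c * f (suc n)) ⟩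
    c * f (suc n) ∎
    where open ≡-Reasoning

  ⊛-identityˡ : ∀ f → 𝟙 ⊛ f ≗ f
  ⊛-identityˡ f n = trans (constS-⊛ 1ℚ f n) (ℚP.*-identityˡ (f n))

  ⊛-identityʳ : ∀ f → f ⊛ 𝟙 ≗ f
  ⊛-identityʳ f n = trans (⊛-comm f 𝟙 n) (⊛-identityˡ f n)

  ⊛-rightComm : ∀ f g h → (f ⊛ g) ⊛ h ≗ (f ⊛ h) ⊛ g
  ⊛-rightComm f g h = begin
    (f ⊛ g) ⊛ h   ≈⟨ ⊛-assoc f g h ⟩
    f ⊛ (g ⊛ h)   ≈⟨ ⊛-congˡ f (⊛-comm g h) ⟩
    f ⊛ (h ⊛ g)   ≈⟨ ⊛-assoc f h g ⟨
    (f ⊛ h) ⊛ g   ∎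
    where open ≗-Reasoning

  ⊛-interchange : ∀ a b c d → (a ⊛ b) ⊛ (c ⊛ d) ≗ (a ⊛ c) ⊛ (b ⊛ d)
  ⊛-interchange a b c d = begin
    (a ⊛ b) ⊛ (c ⊛ d)   ≈⟨ ⊛-assoc (a ⊛ b) c d ⟨
    ((a ⊛ b) ⊛ c) ⊛ d   ≈⟨ ⊛-congʳ d (⊛-rightComm a b c) ⟩
    ((a ⊛ c) ⊛ b) ⊛ d   ≈⟨ ⊛-assoc (a ⊛ c) b d ⟩
    (a ⊛ c) ⊛ (b ⊛ d)   ∎
    where open ≗-Reasoning

  x⊛a≗y⇒x≗y⊛b : ∀ {x y} a b → a ⊛ b ≗ 𝟙 → x ⊛ a ≗ y → x ≗ y ⊛ b
  x⊛a≗y⇒x≗y⊛b {x} {y} a b a⊛b≗𝟙 x⊛a≗y = begin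
    x               ≈⟨ ⊛-identityʳ x ⟨
    x ⊛ 𝟙           ≈⟨ ⊛-congˡ x a⊛b≗𝟙 ⟨
    x ⊛ (a ⊛ b)     ≈⟨ ⊛-assoc x a b ⟨
    (x ⊛ a) ⊛ b     ≈⟨ ⊛-congʳ b x⊛a≗y ⟩
    y ⊛ b           ∎
    where open ≗-Reasoning

  recip-inverseʳ : ∀ q → q ≢ 0ℚ → q * recip q ≡ 1ℚ
  recip-inverseʳ q q≢0 with q ℚ.≟ 0ℚ
  ... | yes q≡0 = ⊥-elim (q≢0 q≡0)
  ... | no  q≢0 = ℚP.*-inverseʳ q {{ℚ.≢-nonZero q≢0}}

  invUpTo-stable : ∀ a {n m} → m ≤ n → invUpTo a n m ≡ invS a m
  invUpTo-stable a {zero}  z≤n = refl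
  invUpTo-stable a {suc n} {m} m≤1+n with ℕP.m≤n⇒m<n∨m≡n m≤1+n
  ... | inj₂ refl = refl
  ... | inj₁ (s≤s m≤n) with m ℕ.≤? n
  ...   | yes _   = invUpTo-stable a m≤n
  ...   | no  m≰n = ⊥-elim (m≰n m≤n)

  invS-suc : ∀ a n → invS a (suc n) ≡ - (recip (a 0) * sumTo n (λ i → a (suc i) * invS a (n ∸ i)))
  invS-suc a n with suc n ℕ.≤? n
  ... | yes 1+n≤n = ⊥-elim (ℕP.<-irrefl refl 1+n≤n)
  ... | no  _     = cong (λ s → - (recip (a 0) * s))
    (sumTo-congʳ n (λ i → cong (a (suc i) *_) (invUpTo-stable a (ℕP.m∸n≤m n i))))

  invS-inverseʳ : ∀ a → a 0 ≢ 0ℚ → a ⊛ invS a ≗ 𝟙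
  invS-inverseʳ a a₀≢0 zero    = recip-inverseʳ (a 0) a₀≢0
  invS-inverseʳ a a₀≢0 (suc n) = begin
    sumTo (suc n) (λ i → a i * invS a (suc n ∸ i))
      ≡⟨ sumTo-suc n (λ i → a i * invS a (suc n ∸ i)) ⟩
    a 0 * invS a (suc n) + S
      ≡⟨ cong (λ t → a 0 * t + S) (invS-suc a n) ⟩
    a 0 * (- (r * S)) + S
      ≡⟨ solve 3 (λ a r s → a :* (:- (r :* s)) :+ s := s :+ :- ((a :* r) :* s)) refl (a 0) r S ⟩
    S + - ((a 0 * r) * S)
      ≡⟨ cong (λ t → S + - (t * S)) (recip-inverseʳ (a 0) a₀≢0) ⟩
    S + - (1ℚ * S)
      ≡⟨ cong (λ t → S + - t) (ℚP.*-identityˡ S) ⟩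
    S + - S
      ≡⟨ ℚP.+-inverseʳ S ⟩
    0ℚ ∎
    where
    open ≡-Reasoning
    r = recip (a 0)
    S = sumTo n (λ i → a (suc i) * invS a (n ∸ i))

  ⊛-invS-cancelʳ : ∀ g a → a 0 ≢ 0ℚ → (g ⊛ invS a) ⊛ a ≗ g
  ⊛-invS-cancelʳ g a a₀≢0 = begin
    (g ⊛ invS a) ⊛ a   ≈⟨ ⊛-assoc g (invS a) a ⟩
    g ⊛ (invS a ⊛ a)   ≈⟨ ⊛-congˡ g (⊛-comm (invS a) a) ⟩
    g ⊛ (a ⊛ invS a)   ≈⟨ ⊛-congˡ g (invS-inverseʳ a a₀≢0) ⟩
    g ⊛ 𝟙              ≈⟨ ⊛-identityʳ g ⟩
    g                  ∎
    where open ≗-Reasoning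

  sumS : ℕ → (ℕ → Series) → Series
  sumS K F n = sumTo K (λ j → F j n)

  sumS-cong : ∀ K {F G : ℕ → Series} → (∀ j → F j ≗ G j) → sumS K F ≗ sumS K G
  sumS-cong K F≗G n = sumTo-congʳ K (λ j → F≗G j n)

  ⊛-sumS : ∀ f K F → f ⊛ sumS K F ≗ sumS K (λ j → f ⊛ F j)
  ⊛-sumS f K F n = trans (sumTo-congʳ n (λ i → *-distribˡ-sumTo K (f i) (λ j → F j (n ∸ i))))
    (sumTo-comm n K (λ i j → f i * F j (n ∸ i)))

  divT-⊛ : ∀ f g → f 0 ≡ 0ℚ → divT (f ⊛ g) ≗ divT f ⊛ g
  divT-⊛ f g f₀≡0 n = sumTo-suc-vanishing n (λ i → f i * g (suc n ∸ i))
    (trans (cong (_* g (suc n)) f₀≡0) (ℚP.*-zeroˡ (g (suc n))))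

  powS-cong : ∀ {f g} m → f ≗ g → powS f m ≗ powS g m
  powS-cong zero    f≗g n = refl
  powS-cong (suc m) f≗g   = ⊛-cong (powS-cong m f≗g) f≗g

  powS-⊛ : ∀ f g m → powS (f ⊛ g) m ≗ powS f m ⊛ powS g m
  powS-⊛ f g zero    n = sym (⊛-identityˡ 𝟙 n)
  powS-⊛ f g (suc m)   = begin
    powS (f ⊛ g) m ⊛ (f ⊛ g)             ≈⟨ ⊛-congʳ (f ⊛ g) (powS-⊛ f g m) ⟩
    (powS f m ⊛ powS g m) ⊛ (f ⊛ g)      ≈⟨ ⊛-interchange (powS f m) (powS g m) f g ⟩
    powS f (suc m) ⊛ powS g (suc m)      ∎
    where open ≗-Reasoning

  powS-scale : ∀ c f m → powS (scale c f) m ≗ scale (qpow c m) (powS f m)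
  powS-scale c f zero    n = sym (ℚP.*-identityˡ (𝟙 n))
  powS-scale c f (suc m) n = begin
    (powS (scale c f) m ⊛ scale c f) n                ≡⟨ ⊛-congʳ (scale c f) (powS-scale c f m) n ⟩
    (scale (qpow c m) (powS f m) ⊛ scale c f) n       ≡⟨ ⊛-scaleˡ (qpow c m) (powS f m) (scale c f) n ⟩
    qpow c m * (powS f m ⊛ scale c f) n               ≡⟨ cong (qpow c m *_) (⊛-scaleʳ c (powS f m) f n) ⟩
    qpow c m * (c * powS f (suc m) n)                 ≡⟨ ℚP.*-assoc (qpow c m) c (powS f (suc m) n) ⟨
    qpow c (suc m) * powS f (suc m) n                 ∎
    where open ≡-Reasoning

  -- Composition

  mulT : Series → Series
  mulT f zero    = 0ℚ
  mulT f (suc n) = f n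

  powS-vanishing : ∀ {g} → g 0 ≡ 0ℚ → ∀ m {N} → N < m → powS g m N ≡ 0ℚ
  powS-vanishing {g} g₀≡0 (suc m) {N} N<1+m = sumTo-zero N term
    where
    term : ∀ i → i ≤ N → powS g m i * g (N ∸ i) ≡ 0ℚ
    term i i≤N with i ℕ.<? m
    ... | yes i<m = trans (cong (_* g (N ∸ i)) (powS-vanishing g₀≡0 m i<m)) (ℚP.*-zeroˡ (g (N ∸ i)))
    ... | no  i≮m = begin
      powS g m i * g (N ∸ i) ≡⟨ cong (λ k → powS g m i * g k) (ℕP.m≤n⇒m∸n≡0 N≤i) ⟩
      powS g m i * g 0       ≡⟨ cong (powS g m i *_) g₀≡0 ⟩
      powS g m i * 0ℚ        ≡⟨ ℚP.*-zeroʳ (powS g m i) ⟩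
      0ℚ                     ∎
      where
      open ≡-Reasoning
      N≤i : N ≤ i
      N≤i = ℕP.≤-trans (ℕP.≤-pred N<1+m) (ℕP.≮⇒≥ i≮m)

  ∘S-extend : ∀ f {g} → g 0 ≡ 0ℚ → ∀ {N M} → N ≤ M → (f ∘S g) N ≡ sumTo M (λ m → f m * powS g m N)
  ∘S-extend f {g} g₀≡0 {N} N≤M = sumTo-extend _ N≤M
    (λ m N<m → trans (cong (f m *_) (powS-vanishing g₀≡0 m N<m)) (ℚP.*-zeroʳ (f m)))

  ∘S-congˡ : ∀ f {g g′} → g ≗ g′ → f ∘S g ≗ f ∘S g′
  ∘S-congˡ f g≗g′ N = sumTo-congʳ N (λ m → cong (f m *_) (powS-cong m g≗g′ N))

  ∘S-congʳ : ∀ {f f′} g → f ≗ f′ → f ∘S g ≗ f′ ∘S g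
  ∘S-congʳ g f≗f′ N = sumTo-congʳ N (λ m → cong (_* powS g m N) (f≗f′ m))

  ∘S-distribʳ-⊕ : ∀ g f h → (f ⊕ h) ∘S g ≗ (f ∘S g) ⊕ (h ∘S g)
  ∘S-distribʳ-⊕ g f h N = trans (sumTo-congʳ N (λ m → ℚP.*-distribʳ-+ (powS g m N) (f m) (h m)))
    (sumTo-+ N (λ m → f m * powS g m N) (λ m → h m * powS g m N))

  ∘S-⊖ : ∀ f g → (⊖ f) ∘S g ≗ ⊖ (f ∘S g)
  ∘S-⊖ f g N = trans (sumTo-congʳ N (λ m → sym (ℚP.neg-distribˡ-* (f m) (powS g m N))))
    (sym (neg-distrib-sumTo N (λ m → f m * powS g m N)))

  ∘S-scale : ∀ c f g → scale c f ∘S g ≗ scale c (f ∘S g)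
  ∘S-scale c f g N = trans (sumTo-congʳ N (λ m → ℚP.*-assoc c (f m) (powS g m N)))
    (sym (*-distribˡ-sumTo N c (λ m → f m * powS g m N)))

  ∘S-sumS : ∀ K F g → sumS K F ∘S g ≗ sumS K (λ j → F j ∘S g)
  ∘S-sumS K F g N = trans (sumTo-congʳ N (λ m → *-distribʳ-sumTo K (powS g m N) (λ j → F j m)))
    (sumTo-comm N K (λ m j → F j m * powS g m N))

  constS-∘S : ∀ c g → constS c ∘S g ≗ constS c
  constS-∘S c g zero    = ℚP.*-identityʳ c
  constS-∘S c g (suc N) = trans (sumTo-suc N (λ m → constS c m * powS g m (suc N)))
    (cong₂ _+_ (ℚP.*-zeroʳ c) (sumTo-zero N (λ m _ → ℚP.*-zeroˡ (powS g (suc m) (suc N)))))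

  mulT-∘S : ∀ f {g} → g 0 ≡ 0ℚ → mulT f ∘S g ≗ g ⊛ (f ∘S g)
  mulT-∘S f {g} g₀≡0 N = begin
    (mulT f ∘S g) N
      ≡⟨ ∘S-extend (mulT f) g₀≡0 (ℕP.n≤1+n N) ⟩
    sumTo (suc N) (λ m → mulT f m * powS g m N)
      ≡⟨ sumTo-suc-vanishing N (λ m → mulT f m * powS g m N) (ℚP.*-zeroˡ (powS g 0 N)) ⟩
    sumTo N (λ m → f m * (powS g m ⊛ g) N)
      ≡⟨ sumTo-congʳ N (λ m → cong (f m *_) (⊛-comm (powS g m) g N)) ⟩
    sumTo N (λ m → f m * sumTo N (λ i → g i * powS g m (N ∸ i)))
      ≡⟨ sumTo-congʳ N (λ m → *-distribˡ-sumTo N (f m) (λ i → g i * powS g m (N ∸ i))) ⟩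
    sumTo N (λ m → sumTo N (λ i → f m * (g i * powS g m (N ∸ i))))
      ≡⟨ sumTo-comm N N (λ m i → f m * (g i * powS g m (N ∸ i))) ⟩
    sumTo N (λ i → sumTo N (λ m → f m * (g i * powS g m (N ∸ i))))
      ≡⟨ sumTo-congʳ N (λ i → sumTo-congʳ N (λ m →
           solve 3 (λ a b c → a :* (b :* c) := b :* (a :* c)) refl (f m) (g i) (powS g m (N ∸ i)))) ⟩
    sumTo N (λ i → sumTo N (λ m → g i * (f m * powS g m (N ∸ i))))
      ≡⟨ sumTo-congʳ N (λ i → sym (*-distribˡ-sumTo N (g i) (λ m → f m * powS g m (N ∸ i)))) ⟩
    sumTo N (λ i → g i * sumTo N (λ m → f m * powS g m (N ∸ i)))
      ≡⟨ sumTo-congʳ N (λ i → cong (g i *_) (sym (∘S-extend f g₀≡0 (ℕP.m∸n≤m N i)))) ⟩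
    (g ⊛ (f ∘S g)) N ∎
    where open ≡-Reasoning

  ∘S-difference : ∀ f {g} → g 0 ≡ 0ℚ → (f ⊕ (⊖ mulT f)) ∘S g ≗ (𝟙 ⊕ (⊖ g)) ⊛ (f ∘S g)
  ∘S-difference f {g} g₀≡0 = begin
    (f ⊕ (⊖ mulT f)) ∘S g                     ≈⟨ ∘S-distribʳ-⊕ g f (⊖ mulT f) ⟩
    (f ∘S g) ⊕ ((⊖ mulT f) ∘S g)              ≈⟨ ⊕-congˡ (f ∘S g) (∘S-⊖ (mulT f) g) ⟩
    (f ∘S g) ⊕ (⊖ (mulT f ∘S g))              ≈⟨ ⊕-congˡ (f ∘S g) (⊖-cong (mulT-∘S f g₀≡0)) ⟩
    (f ∘S g) ⊕ (⊖ (g ⊛ (f ∘S g)))             ≈⟨ ⊕-cong (⊛-identityˡ (f ∘S g)) (⊛-negˡ g (f ∘S g)) ⟨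
    (𝟙 ⊛ (f ∘S g)) ⊕ ((⊖ g) ⊛ (f ∘S g))       ≈⟨ ⊛-distribʳ-⊕ (f ∘S g) 𝟙 (⊖ g) ⟨
    (𝟙 ⊕ (⊖ g)) ⊛ (f ∘S g)                    ∎
    where open ≗-Reasoning

  -- Substitution t ↦ −t

  sgn : ℕ → ℚ
  sgn = qpow (- 1ℚ)

  qpow-+ : ∀ q m n → qpow q (m ℕ.+ n) ≡ qpow q m * qpow q n
  qpow-+ q m zero    = trans (cong (qpow q) (ℕP.+-identityʳ m)) (sym (ℚP.*-identityʳ (qpow q m)))
  qpow-+ q m (suc n) = trans (cong (qpow q) (ℕP.+-suc m n))
    (trans (cong (_* q) (qpow-+ q m n)) (ℚP.*-assoc (qpow q m) (qpow q n) q))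

  qpow-neg : ∀ q n → qpow (- q) n ≡ sgn n * qpow q n
  qpow-neg q zero    = refl
  qpow-neg q (suc n) = trans (cong (_* - q) (qpow-neg q n))
    (solve 3 (λ s p q → (s :* p) :* (:- q) := (s :* (:- con 1ℚ)) :* (p :* q)) refl (sgn n) (qpow q n) q)

  sgn-*-sgn : ∀ n → sgn n * sgn n ≡ 1ℚ
  sgn-*-sgn zero    = refl
  sgn-*-sgn (suc n) = trans
    (solve 1 (λ s → (s :* (:- con 1ℚ)) :* (s :* (:- con 1ℚ)) := s :* s) refl (sgn n)) (sgn-*-sgn n)

  sgn-even : ∀ n → sgn (2 ℕ.* n) ≡ 1ℚ
  sgn-even n = begin
    sgn (n ℕ.+ (n ℕ.+ 0))  ≡⟨ cong (λ m → sgn (n ℕ.+ m)) (ℕP.+-identityʳ n) ⟩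
    sgn (n ℕ.+ n)          ≡⟨ qpow-+ (- 1ℚ) n n ⟩
    sgn n * sgn n          ≡⟨ sgn-*-sgn n ⟩
    1ℚ                     ∎
    where open ≡-Reasoning

  reflect : Series → Series
  reflect f n = sgn n * f n

  reflect-cong : ∀ {f g} → f ≗ g → reflect f ≗ reflect g
  reflect-cong f≗g n = cong (sgn n *_) (f≗g n)

  reflect-⊕ : ∀ f g → reflect (f ⊕ g) ≗ reflect f ⊕ reflect g
  reflect-⊕ f g n = ℚP.*-distribˡ-+ (sgn n) (f n) (g n)

  reflect-⊖ : ∀ f → reflect (⊖ f) ≗ ⊖ reflect f
  reflect-⊖ f n = sym (ℚP.neg-distribʳ-* (sgn n) (f n))

  reflect-constS : ∀ c → reflect (constS c) ≗ constS c
  reflect-constS c zero    = ℚP.*-identityˡ c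
  reflect-constS c (suc n) = ℚP.*-zeroʳ (sgn (suc n))

  reflect-⊛ : ∀ f g → reflect (f ⊛ g) ≗ reflect f ⊛ reflect g
  reflect-⊛ f g n = trans (*-distribˡ-sumTo n (sgn n) (λ i → f i * g (n ∸ i))) (sumTo-cong n term)
    where
    term : ∀ i → i ≤ n → sgn n * (f i * g (n ∸ i)) ≡ (sgn i * f i) * (sgn (n ∸ i) * g (n ∸ i))
    term i i≤n = trans
      (cong (_* (f i * g (n ∸ i))) (trans (cong sgn (sym (ℕP.m+[n∸m]≡n i≤n))) (qpow-+ (- 1ℚ) i (n ∸ i))))
      (solve 4 (λ a b x y → (a :* b) :* (x :* y) := (a :* x) :* (b :* y)) refl
        (sgn i) (sgn (n ∸ i)) (f i) (g (n ∸ i)))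

  reflect-powS : ∀ g m → reflect (powS g m) ≗ powS (reflect g) m
  reflect-powS g zero    = reflect-constS 1ℚ
  reflect-powS g (suc m) n =
    trans (reflect-⊛ (powS g m) g n) (⊛-congʳ (reflect g) (reflect-powS g m) n)

  reflect-∘S : ∀ f g → reflect (f ∘S g) ≗ f ∘S reflect g
  reflect-∘S f g N = trans (*-distribˡ-sumTo N (sgn N) (λ m → f m * powS g m N)) (sumTo-congʳ N (λ m →
    trans (solve 3 (λ s a x → s :* (a :* x) := a :* (s :* x)) refl (sgn N) (f m) (powS g m N))
          (cong (f m *_) (reflect-powS g m N))))

  powS-⊖ : ∀ g m → powS (⊖ g) m ≗ scale (sgn m) (powS g m)
  powS-⊖ g zero    n = sym (ℚP.*-identityˡ (𝟙 n))
  powS-⊖ g (suc m) n = begin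
    (powS (⊖ g) m ⊛ (⊖ g)) n             ≡⟨ ⊛-negʳ (powS (⊖ g) m) g n ⟩
    - (powS (⊖ g) m ⊛ g) n              ≡⟨ cong -_ (⊛-congʳ g (powS-⊖ g m) n) ⟩
    - (scale (sgn m) (powS g m) ⊛ g) n  ≡⟨ cong -_ (⊛-scaleˡ (sgn m) (powS g m) g n) ⟩
    - (sgn m * powS g (suc m) n)        ≡⟨ solve 2 (λ s x → :- (s :* x) := (s :* (:- con 1ℚ)) :* x) refl (sgn m) (powS g (suc m) n) ⟩
    sgn (suc m) * powS g (suc m) n      ∎
    where open ≡-Reasoning

  reflect-∘Sʳ : ∀ f g → reflect f ∘S g ≗ f ∘S (⊖ g)
  reflect-∘Sʳ f g N = sumTo-congʳ N (λ m → begin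
    sgn m * f m * powS g m N      ≡⟨ solve 3 (λ s a x → (s :* a) :* x := a :* (s :* x)) refl (sgn m) (f m) (powS g m N) ⟩
    f m * (sgn m * powS g m N)    ≡⟨ cong (f m *_) (powS-⊖ g m N) ⟨
    f m * powS (⊖ g) m N          ∎)
    where open ≡-Reasoning

  -- Formal derivative and the exponential series

  deriv : Series → Series
  deriv f n = fromℕ (suc n) * f (suc n)

  deriv-⊕ : ∀ f g → deriv (f ⊕ g) ≗ deriv f ⊕ deriv g
  deriv-⊕ f g n = ℚP.*-distribˡ-+ (fromℕ (suc n)) (f (suc n)) (g (suc n))

  deriv-⊖ : ∀ f → deriv (⊖ f) ≗ ⊖ deriv f
  deriv-⊖ f n = sym (ℚP.neg-distribʳ-* (fromℕ (suc n)) (f (suc n)))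

  deriv-constS : ∀ c → deriv (constS c) ≗ constS 0ℚ
  deriv-constS c zero    = ℚP.*-zeroʳ (fromℕ 1)
  deriv-constS c (suc n) = ℚP.*-zeroʳ (fromℕ (suc (suc n)))

  deriv-⊛ : ∀ f g → deriv (f ⊛ g) ≗ (deriv f ⊛ g) ⊕ (f ⊛ deriv g)
  deriv-⊛ f g n = begin
    fromℕ (suc n) * sumTo (suc n) (λ i → f i * g (suc n ∸ i))
      ≡⟨ *-distribˡ-sumTo (suc n) (fromℕ (suc n)) _ ⟩
    sumTo (suc n) (λ i → fromℕ (suc n) * (f i * g (suc n ∸ i)))
      ≡⟨ sumTo-cong (suc n) split ⟩
    sumTo (suc n) (λ i → fromℕ i * (f i * g (suc n ∸ i)) + fromℕ (suc n ∸ i) * (f i * g (suc n ∸ i)))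
      ≡⟨ sumTo-+ (suc n) _ _ ⟩
    sumTo (suc n) (λ i → fromℕ i * (f i * g (suc n ∸ i))) + sumTo (suc n) (λ i → fromℕ (suc n ∸ i) * (f i * g (suc n ∸ i)))
      ≡⟨ cong₂ _+_ (weighted f g) (trans (sumTo-reverse₂ (suc n) (λ i j → fromℕ j * (f i * g j))) swapped) ⟩
    (deriv f ⊛ g) n + (f ⊛ deriv g) n ∎
    where
    open ≡-Reasoning
    split : ∀ i → i ≤ suc n → fromℕ (suc n) * (f i * g (suc n ∸ i))
                              ≡ fromℕ i * (f i * g (suc n ∸ i)) + fromℕ (suc n ∸ i) * (f i * g (suc n ∸ i))
    split i i≤1+n = trans (cong (λ m → fromℕ m * (f i * g (suc n ∸ i))) (sym (ℕP.m+[n∸m]≡n i≤1+n)))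
      (trans (cong (_* (f i * g (suc n ∸ i))) (fromℕ-+ i (suc n ∸ i)))
             (ℚP.*-distribʳ-+ _ (fromℕ i) (fromℕ (suc n ∸ i))))
    weighted : ∀ f g → sumTo (suc n) (λ i → fromℕ i * (f i * g (suc n ∸ i))) ≡ (deriv f ⊛ g) n
    weighted f g = trans (sumTo-suc-vanishing n _ (ℚP.*-zeroˡ (f 0 * g (suc n))))
      (sumTo-congʳ n (λ i → sym (ℚP.*-assoc (fromℕ (suc i)) (f (suc i)) (g (n ∸ i)))))
    swapped : sumTo (suc n) (λ i → fromℕ i * (f (suc n ∸ i) * g i)) ≡ (f ⊛ deriv g) n
    swapped = trans (sumTo-congʳ (suc n) (λ i → cong (fromℕ i *_) (ℚP.*-comm (f (suc n ∸ i)) (g i))))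
                    (trans (weighted g f) (⊛-comm (deriv g) f n))

  deriv-powS : ∀ g p → deriv (powS g (suc p)) ≗ scale (fromℕ (suc p)) (powS g p ⊛ deriv g)
  deriv-powS g zero n = begin
    deriv (𝟙 ⊛ g) n
      ≡⟨ deriv-⊛ 𝟙 g n ⟩
    (deriv 𝟙 ⊛ g) n + (𝟙 ⊛ deriv g) n
      ≡⟨ cong (_+ (𝟙 ⊛ deriv g) n) (trans (⊛-congʳ g (deriv-constS 1ℚ) n) (constS-⊛ 0ℚ g n)) ⟩
    0ℚ * g n + (𝟙 ⊛ deriv g) n
      ≡⟨ solve 2 (λ x y → con 0ℚ :* x :+ y := con 1ℚ :* y) refl (g n) _ ⟩
    1ℚ * (𝟙 ⊛ deriv g) n ∎
    where open ≡-Reasoning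
  deriv-powS g (suc p) n = begin
    deriv (powS g (suc p) ⊛ g) n
      ≡⟨ deriv-⊛ (powS g (suc p)) g n ⟩
    (deriv (powS g (suc p)) ⊛ g) n + X
      ≡⟨ cong (_+ X) (⊛-congʳ g (deriv-powS g p) n) ⟩
    (scale (fromℕ (suc p)) (powS g p ⊛ deriv g) ⊛ g) n + X
      ≡⟨ cong (_+ X) (⊛-scaleˡ (fromℕ (suc p)) (powS g p ⊛ deriv g) g n) ⟩
    fromℕ (suc p) * ((powS g p ⊛ deriv g) ⊛ g) n + X
      ≡⟨ cong (λ t → fromℕ (suc p) * t + X) (⊛-rightComm (powS g p) (deriv g) g n) ⟩
    fromℕ (suc p) * X + X
      ≡⟨ solve 2 (λ a x → a :* x :+ x := (con 1ℚ :+ a) :* x) refl (fromℕ (suc p)) X ⟩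
    (1ℚ + fromℕ (suc p)) * X
      ≡⟨ cong (_* X) (fromℕ-+ 1 (suc p)) ⟨
    fromℕ (suc (suc p)) * X ∎
    where
    open ≡-Reasoning
    X = (powS g (suc p) ⊛ deriv g) n

  deriv-unique : ∀ c {f g} → deriv f ≗ scale c f → deriv g ≗ scale c g → f 0 ≡ g 0 → f ≗ g
  deriv-unique c {f} {g} f′≈cf g′≈cg f₀≡g₀ zero    = f₀≡g₀
  deriv-unique c {f} {g} f′≈cf g′≈cg f₀≡g₀ (suc n) = begin
    f (suc n)                              ≡⟨ undo-deriv (f (suc n)) ⟩
    1/[n+1] * (fromℕ (suc n) * f (suc n))  ≡⟨ cong (1/[n+1] *_) (f′≈cf n) ⟩
    1/[n+1] * (c * f n)                    ≡⟨ cong (λ x → 1/[n+1] * (c * x)) (deriv-unique c f′≈cf g′≈cg f₀≡g₀ n) ⟩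
    1/[n+1] * (c * g n)                    ≡⟨ cong (1/[n+1] *_) (g′≈cg n) ⟨
    1/[n+1] * (fromℕ (suc n) * g (suc n))  ≡⟨ undo-deriv (g (suc n)) ⟨
    g (suc n)                              ∎
    where
    open ≡-Reasoning
    1/[n+1] = ℤ.+ 1 / suc n
    undo-deriv : ∀ x → x ≡ 1/[n+1] * (fromℕ (suc n) * x)
    undo-deriv x = sym (begin
      1/[n+1] * (fromℕ (suc n) * x)   ≡⟨ ℚP.*-assoc 1/[n+1] (fromℕ (suc n)) x ⟨
      (1/[n+1] * fromℕ (suc n)) * x   ≡⟨ cong (_* x) (trans (ℚP.*-comm 1/[n+1] (fromℕ (suc n))) (fromℕ-*-inverse n)) ⟩
      1ℚ * x                          ≡⟨ ℚP.*-identityˡ x ⟩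
      x                               ∎)

  deriv-expS : ∀ c → deriv (expS c) ≗ scale c (expS c)
  deriv-expS c n = begin
    fromℕ (suc n) * (qpow c n * c * (invFact n * 1/[n+1]))
      ≡⟨ solve 5 (λ a q c f i → a :* (q :* c :* (f :* i)) := (c :* (q :* f)) :* (a :* i)) refl
           (fromℕ (suc n)) (qpow c n) c (invFact n) 1/[n+1] ⟩
    (c * (qpow c n * invFact n)) * (fromℕ (suc n) * 1/[n+1])
      ≡⟨ cong ((c * (qpow c n * invFact n)) *_) (fromℕ-*-inverse n) ⟩
    (c * (qpow c n * invFact n)) * 1ℚ
      ≡⟨ ℚP.*-identityʳ _ ⟩
    c * (qpow c n * invFact n) ∎
    where
    open ≡-Reasoning
    1/[n+1] = ℤ.+ 1 / suc n

  expS-+ : ∀ a b → expS a ⊛ expS b ≗ expS (a + b)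
  expS-+ a b = deriv-unique (a + b) deriv-product (deriv-expS (a + b)) refl
    where
    deriv-product : deriv (expS a ⊛ expS b) ≗ scale (a + b) (expS a ⊛ expS b)
    deriv-product n = begin
      deriv (expS a ⊛ expS b) n
        ≡⟨ deriv-⊛ (expS a) (expS b) n ⟩
      (deriv (expS a) ⊛ expS b) n + (expS a ⊛ deriv (expS b)) n
        ≡⟨ cong₂ _+_ (⊛-congʳ (expS b) (deriv-expS a) n) (⊛-congˡ (expS a) (deriv-expS b) n) ⟩
      (scale a (expS a) ⊛ expS b) n + (expS a ⊛ scale b (expS b)) n
        ≡⟨ cong₂ _+_ (⊛-scaleˡ a (expS a) (expS b) n) (⊛-scaleʳ b (expS a) (expS b) n) ⟩
      a * (expS a ⊛ expS b) n + b * (expS a ⊛ expS b) n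
        ≡⟨ ℚP.*-distribʳ-+ ((expS a ⊛ expS b) n) a b ⟨
      (a + b) * (expS a ⊛ expS b) n ∎
      where open ≡-Reasoning

  expS-zero : expS 0ℚ ≗ 𝟙
  expS-zero zero    = refl
  expS-zero (suc n) = trans (cong (_* invFact (suc n)) (ℚP.*-zeroʳ (qpow 0ℚ n))) (ℚP.*-zeroˡ (invFact (suc n)))

  reflect-expS : ∀ c → reflect (expS c) ≗ expS (- c)
  reflect-expS c n = trans (sym (ℚP.*-assoc (sgn n) (qpow c n) (invFact n)))
    (cong (_* invFact n) (sym (qpow-neg c n)))

  reflect-expS-⊛-expS : ∀ c → reflect (expS c) ⊛ expS c ≗ 𝟙
  reflect-expS-⊛-expS c = begin
    reflect (expS c) ⊛ expS c   ≈⟨ ⊛-congʳ (expS c) (reflect-expS c) ⟩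
    expS (- c) ⊛ expS c         ≈⟨ expS-+ (- c) c ⟩
    expS (- c + c)              ≈⟨ (λ n → cong (λ a → expS a n) (ℚP.+-inverseˡ c)) ⟩
    expS 0ℚ                     ≈⟨ expS-zero ⟩
    𝟙                           ∎
    where open ≗-Reasoning

  two : ℚ
  two = 1ℚ + 1ℚ

  ½ : ℚ
  ½ = ℤ.+ 1 / 2

  expMinus1 expPlus1 : ℚ → Series
  expMinus1 c = expS c ⊕ (⊖ 𝟙)
  expPlus1  c = expS c ⊕ 𝟙

  -- tanhHalf c is tanh(ct/2); tanhHalfS and tanhS are tanhHalf 1ℚ and tanhHalf two by definition.
  tanhHalf : ℚ → Series
  tanhHalf c = expMinus1 c ⊛ invS (expPlus1 c)

  expPlus1₀≢0 : ∀ c → expPlus1 c 0 ≢ 0ℚ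
  expPlus1₀≢0 c ()

  tanhHalf-⊛-expPlus1 : ∀ c → tanhHalf c ⊛ expPlus1 c ≗ expMinus1 c
  tanhHalf-⊛-expPlus1 c = ⊛-invS-cancelʳ (expMinus1 c) (expPlus1 c) (expPlus1₀≢0 c)

  reflect-expPlus1 : ∀ c → reflect (expPlus1 c) ⊛ expS c ≗ expPlus1 c
  reflect-expPlus1 c = begin
    reflect (expS c ⊕ 𝟙) ⊛ expS c                ≈⟨ ⊛-congʳ (expS c) reflect-E⊕𝟙 ⟩
    (reflect (expS c) ⊕ 𝟙) ⊛ expS c              ≈⟨ ⊛-distribʳ-⊕ (expS c) (reflect (expS c)) 𝟙 ⟩
    (reflect (expS c) ⊛ expS c) ⊕ (𝟙 ⊛ expS c)   ≈⟨ ⊕-cong (reflect-expS-⊛-expS c) (⊛-identityˡ (expS c)) ⟩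
    𝟙 ⊕ expS c                                   ≈⟨ (λ n → ℚP.+-comm (𝟙 n) (expS c n)) ⟩
    expS c ⊕ 𝟙                                   ∎
    where
    open ≗-Reasoning
    reflect-E⊕𝟙 : reflect (expS c ⊕ 𝟙) ≗ reflect (expS c) ⊕ 𝟙
    reflect-E⊕𝟙 n = trans (reflect-⊕ (expS c) 𝟙 n) (cong (reflect (expS c) n +_) (reflect-constS 1ℚ n))

  reflect-expMinus1 : ∀ c → reflect (expMinus1 c) ⊛ expS c ≗ ⊖ expMinus1 c
  reflect-expMinus1 c = begin
    reflect (expS c ⊕ (⊖ 𝟙)) ⊛ expS c                ≈⟨ ⊛-congʳ (expS c) reflect-E⊖𝟙 ⟩
    (reflect (expS c) ⊕ (⊖ 𝟙)) ⊛ expS c              ≈⟨ ⊛-distribʳ-⊕ (expS c) (reflect (expS c)) (⊖ 𝟙) ⟩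
    (reflect (expS c) ⊛ expS c) ⊕ ((⊖ 𝟙) ⊛ expS c)   ≈⟨ ⊕-cong (reflect-expS-⊛-expS c) (⊛-negˡ 𝟙 (expS c)) ⟩
    𝟙 ⊕ (⊖ (𝟙 ⊛ expS c))                             ≈⟨ ⊕-congˡ 𝟙 (⊖-cong (⊛-identityˡ (expS c))) ⟩
    𝟙 ⊕ (⊖ expS c)                                   ≈⟨ (λ n → solve 2 (λ o e → o :+ :- e := :- (e :+ :- o)) refl (𝟙 n) (expS c n)) ⟩
    ⊖ (expS c ⊕ (⊖ 𝟙))                               ∎
    where
    open ≗-Reasoning
    reflect-E⊖𝟙 : reflect (expS c ⊕ (⊖ 𝟙)) ≗ reflect (expS c) ⊕ (⊖ 𝟙)
    reflect-E⊖𝟙 n = trans (reflect-⊕ (expS c) (⊖ 𝟙) n)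
      (cong (reflect (expS c) n +_) (trans (reflect-⊖ 𝟙 n) (cong -_ (reflect-constS 1ℚ n))))

  -- Under t ↦ −t, e^{ct} + 1 becomes e^{−ct}(e^{ct} + 1) and e^{ct} − 1 becomes −e^{−ct}(e^{ct} − 1).
  tanhHalf-odd : ∀ c → reflect (tanhHalf c) ≗ ⊖ tanhHalf c
  tanhHalf-odd c = begin
    reflect q                 ≈⟨ x⊛a≗y⇒x≗y⊛b D (invS D) (invS-inverseʳ D (expPlus1₀≢0 c)) reflect-q⊛D ⟩
    (⊖ N) ⊛ invS D            ≈⟨ ⊛-negˡ N (invS D) ⟩
    ⊖ q                       ∎
    where
    open ≗-Reasoning
    q = tanhHalf c
    N = expMinus1 c
    D = expPlus1 c
    reflect-q⊛D : reflect q ⊛ D ≗ ⊖ N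
    reflect-q⊛D = begin
      reflect q ⊛ D                           ≈⟨ ⊛-congˡ (reflect q) (reflect-expPlus1 c) ⟨
      reflect q ⊛ (reflect D ⊛ expS c)        ≈⟨ ⊛-assoc (reflect q) (reflect D) (expS c) ⟨
      (reflect q ⊛ reflect D) ⊛ expS c        ≈⟨ ⊛-congʳ (expS c) (reflect-⊛ q D) ⟨
      reflect (q ⊛ D) ⊛ expS c                ≈⟨ ⊛-congʳ (expS c) (reflect-cong (tanhHalf-⊛-expPlus1 c)) ⟩
      reflect N ⊛ expS c                      ≈⟨ reflect-expMinus1 c ⟩
      ⊖ N                                     ∎

  -- Binomial coefficients and Stirling numbers of the second kind

  binomialSeries : ℕ → Series
  binomialSeries j m = fromℕ (m C j)

  binomialSeries-difference₀ : binomialSeries 0 ⊕ (⊖ mulT (binomialSeries 0)) ≗ 𝟙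
  binomialSeries-difference₀ zero    = refl
  binomialSeries-difference₀ (suc m) = refl

  binomialSeries-difference : ∀ j →
    binomialSeries (suc j) ⊕ (⊖ mulT (binomialSeries (suc j))) ≗ mulT (binomialSeries j)
  binomialSeries-difference j zero    = refl
  binomialSeries-difference j (suc m) = begin
    fromℕ (suc m C suc j) + - fromℕ (m C suc j)
      ≡⟨ cong (λ x → fromℕ x + - fromℕ (m C suc j)) (nCk+nC[k+1]≡[n+1]C[k+1] m j) ⟨
    fromℕ (m C j ℕ.+ m C suc j) + - fromℕ (m C suc j)
      ≡⟨ cong (_+ - fromℕ (m C suc j)) (fromℕ-+ (m C j) (m C suc j)) ⟩
    (fromℕ (m C j) + fromℕ (m C suc j)) + - fromℕ (m C suc j)
      ≡⟨ solve 2 (λ a b → (a :+ b) :+ :- b := a) refl (fromℕ (m C j)) (fromℕ (m C suc j)) ⟩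
    fromℕ (m C j) ∎
    where open ≡-Reasoning

  binomialSeries-∘S : ∀ {g h} → g 0 ≡ 0ℚ → (𝟙 ⊕ (⊖ g)) ⊛ h ≗ 𝟙 →
    ∀ j → binomialSeries j ∘S g ≗ powS g j ⊛ powS h (suc j)
  binomialSeries-∘S {g} {h} g₀≡0 Q⊛h≗𝟙 zero = begin
    B₀                ≈⟨ x⊛a≗y⇒x≗y⊛b Q h Q⊛h≗𝟙 (λ n → trans (⊛-comm B₀ Q n) (Q⊛B₀ n)) ⟩
    𝟙 ⊛ h             ≈⟨ ⊛-identityˡ (𝟙 ⊛ h) ⟨
    𝟙 ⊛ (𝟙 ⊛ h)       ∎
    where
    open ≗-Reasoning
    Q = 𝟙 ⊕ (⊖ g)
    B₀ = binomialSeries 0 ∘S g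
    Q⊛B₀ : Q ⊛ B₀ ≗ 𝟙
    Q⊛B₀ = begin
      Q ⊛ B₀                                                         ≈⟨ ∘S-difference (binomialSeries 0) g₀≡0 ⟨
      (binomialSeries 0 ⊕ (⊖ mulT (binomialSeries 0))) ∘S g          ≈⟨ ∘S-congʳ g binomialSeries-difference₀ ⟩
      𝟙 ∘S g                                                         ≈⟨ constS-∘S 1ℚ g ⟩
      𝟙                                                              ∎
  binomialSeries-∘S {g} {h} g₀≡0 Q⊛h≗𝟙 (suc j) = begin
    Bⱼ₊₁                                                  ≈⟨ x⊛a≗y⇒x≗y⊛b Q h Q⊛h≗𝟙 (λ n → trans (⊛-comm Bⱼ₊₁ Q n) (Q⊛Bⱼ₊₁ n)) ⟩
    (g ⊛ (powS g j ⊛ powS h (suc j))) ⊛ h                 ≈⟨ ⊛-congʳ h (⊛-assoc g (powS g j) (powS h (suc j))) ⟨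
    ((g ⊛ powS g j) ⊛ powS h (suc j)) ⊛ h                 ≈⟨ ⊛-congʳ h (⊛-congʳ (powS h (suc j)) (⊛-comm g (powS g j))) ⟩
    (powS g (suc j) ⊛ powS h (suc j)) ⊛ h                 ≈⟨ ⊛-assoc (powS g (suc j)) (powS h (suc j)) h ⟩
    powS g (suc j) ⊛ powS h (suc (suc j))                 ∎
    where
    open ≗-Reasoning
    Q = 𝟙 ⊕ (⊖ g)
    Bⱼ₊₁ = binomialSeries (suc j) ∘S g
    Q⊛Bⱼ₊₁ : Q ⊛ Bⱼ₊₁ ≗ g ⊛ (powS g j ⊛ powS h (suc j))
    Q⊛Bⱼ₊₁ = begin
      Q ⊛ Bⱼ₊₁                                                           ≈⟨ ∘S-difference (binomialSeries (suc j)) g₀≡0 ⟨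
      (binomialSeries (suc j) ⊕ (⊖ mulT (binomialSeries (suc j)))) ∘S g  ≈⟨ ∘S-congʳ g (binomialSeries-difference j) ⟩
      mulT (binomialSeries j) ∘S g                                       ≈⟨ mulT-∘S (binomialSeries j) g₀≡0 ⟩
      g ⊛ (binomialSeries j ∘S g)                                        ≈⟨ ⊛-congˡ g (binomialSeries-∘S g₀≡0 Q⊛h≗𝟙 j) ⟩
      g ⊛ (powS g j ⊛ powS h (suc j))                                    ∎

  stirling2-vanishing : ∀ {n m} → n < m → stirling2 n m ≡ 0
  stirling2-vanishing {zero}  {suc m} _ = refl
  stirling2-vanishing {suc n} {suc m} (s≤s n<m) = cong₂ ℕ._+_ (stirling2-vanishing n<m)
    (trans (cong (suc m ℕ.*_) (stirling2-vanishing (ℕP.m<n⇒m<1+n n<m))) (ℕP.*-zeroʳ (suc m)))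

  deriv-expMinus1 : deriv (expMinus1 1ℚ) ≗ 𝟙 ⊕ expMinus1 1ℚ
  deriv-expMinus1 n = begin
    deriv (expS 1ℚ ⊕ (⊖ 𝟙)) n
      ≡⟨ deriv-⊕ (expS 1ℚ) (⊖ 𝟙) n ⟩
    deriv (expS 1ℚ) n + deriv (⊖ 𝟙) n
      ≡⟨ cong₂ _+_ (deriv-expS 1ℚ n) (trans (deriv-⊖ 𝟙 n) (cong -_ (deriv-constS 1ℚ n))) ⟩
    1ℚ * expS 1ℚ n + - constS 0ℚ n
      ≡⟨ cong (λ z → 1ℚ * expS 1ℚ n + - z) (constS0 n) ⟩
    1ℚ * expS 1ℚ n + - 0ℚ
      ≡⟨ solve 2 (λ e o → con 1ℚ :* e :+ :- con 0ℚ := o :+ (e :+ :- o)) refl (expS 1ℚ n) (𝟙 n) ⟩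
    𝟙 n + (expS 1ℚ n + - 𝟙 n) ∎
    where
    open ≡-Reasoning
    constS0 : ∀ n → constS 0ℚ n ≡ 0ℚ
    constS0 zero    = refl
    constS0 (suc n) = refl

  stirling2-coefficient : ∀ N p → fromℕ (N !) * powS (expMinus1 1ℚ) p N ≡ fromℕ (p ! ℕ.* stirling2 N p)
  stirling2-coefficient zero    zero    = refl
  stirling2-coefficient zero    (suc p) = begin
    fromℕ 1 * (powS u p 0 * u 0)   ≡⟨ cong (λ x → fromℕ 1 * x) (ℚP.*-zeroʳ (powS u p 0)) ⟩
    fromℕ 1 * 0ℚ                   ≡⟨ ℚP.*-zeroʳ (fromℕ 1) ⟩
    0ℚ                             ≡⟨ cong fromℕ (ℕP.*-zeroʳ (suc p !)) ⟨
    fromℕ (suc p ! ℕ.* 0)          ∎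
    where
    open ≡-Reasoning
    u = expMinus1 1ℚ
  stirling2-coefficient (suc N) zero    = trans (ℚP.*-zeroʳ (fromℕ (suc N !))) refl
  stirling2-coefficient (suc N) (suc p) = begin
    fromℕ (suc N ℕ.* N !) * uᵖ⁺¹ (suc N)
      ≡⟨ cong (_* uᵖ⁺¹ (suc N)) (fromℕ-* (suc N) (N !)) ⟩
    (fromℕ (suc N) * fromℕ (N !)) * uᵖ⁺¹ (suc N)
      ≡⟨ solve 3 (λ a b c → (a :* b) :* c := b :* (a :* c)) refl (fromℕ (suc N)) (fromℕ (N !)) (uᵖ⁺¹ (suc N)) ⟩
    fromℕ (N !) * deriv (powS u (suc p)) N
      ≡⟨ cong (fromℕ (N !) *_) (deriv-powS u p N) ⟩
    fromℕ (N !) * (fromℕ (suc p) * (powS u p ⊛ deriv u) N)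
      ≡⟨ cong (λ x → fromℕ (N !) * (fromℕ (suc p) * x)) (⊛-congˡ (powS u p) deriv-expMinus1 N) ⟩
    fromℕ (N !) * (fromℕ (suc p) * (powS u p ⊛ (𝟙 ⊕ u)) N)
      ≡⟨ cong (λ x → fromℕ (N !) * (fromℕ (suc p) * x))
           (trans (⊛-distribˡ-⊕ (powS u p) 𝟙 u N) (cong (_+ uᵖ⁺¹ N) (⊛-identityʳ (powS u p) N))) ⟩
    fromℕ (N !) * (fromℕ (suc p) * (powS u p N + uᵖ⁺¹ N))
      ≡⟨ solve 4 (λ f a y z → f :* (a :* (y :+ z)) := a :* (f :* y) :+ a :* (f :* z)) refl
           (fromℕ (N !)) (fromℕ (suc p)) (powS u p N) (uᵖ⁺¹ N) ⟩
    fromℕ (suc p) * (fromℕ (N !) * powS u p N) + fromℕ (suc p) * (fromℕ (N !) * uᵖ⁺¹ N)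
      ≡⟨ cong₂ (λ x y → fromℕ (suc p) * x + fromℕ (suc p) * y)
           (stirling2-coefficient N p) (stirling2-coefficient N (suc p)) ⟩
    fromℕ (suc p) * fromℕ (p ! ℕ.* S₀) + fromℕ (suc p) * fromℕ (suc p ! ℕ.* S₁)
      ≡⟨ cong₂ _+_ (fromℕ-* (suc p) (p ! ℕ.* S₀)) (fromℕ-* (suc p) (suc p ! ℕ.* S₁)) ⟨
    fromℕ (suc p ℕ.* (p ! ℕ.* S₀)) + fromℕ (suc p ℕ.* (suc p ! ℕ.* S₁))
      ≡⟨ fromℕ-+ (suc p ℕ.* (p ! ℕ.* S₀)) (suc p ℕ.* (suc p ! ℕ.* S₁)) ⟨
    fromℕ (suc p ℕ.* (p ! ℕ.* S₀) ℕ.+ suc p ℕ.* (suc p ! ℕ.* S₁))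
      ≡⟨ cong fromℕ (regroup p (p !) S₀ S₁) ⟩
    fromℕ (suc p ! ℕ.* stirling2 (suc N) (suc p)) ∎
    where
    open ≡-Reasoning
    u = expMinus1 1ℚ
    uᵖ⁺¹ = powS u (suc p)
    S₀ = stirling2 N p
    S₁ = stirling2 N (suc p)
    regroup : ∀ p f a b → suc p ℕ.* (f ℕ.* a) ℕ.+ suc p ℕ.* ((suc p ℕ.* f) ℕ.* b)
                        ≡ (suc p ℕ.* f) ℕ.* (a ℕ.+ suc p ℕ.* b)
    regroup = solve-∀

  m*mCj≡[j+1]*mC[j+1]+j*mCj : ∀ m j → m ℕ.* (m C j) ≡ suc j ℕ.* (m C suc j) ℕ.+ j ℕ.* (m C j)
  m*mCj≡[j+1]*mC[j+1]+j*mCj zero    zero    = refl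
  m*mCj≡[j+1]*mC[j+1]+j*mCj zero    (suc j) = sym (cong₂ ℕ._+_ (ℕP.*-zeroʳ (suc (suc j))) (ℕP.*-zeroʳ (suc j)))
  m*mCj≡[j+1]*mC[j+1]+j*mCj (suc m) zero    =
    trans (ℕP.*-identityʳ (suc m)) (sym (trans (ℕP.+-identityʳ _) (trans (ℕP.+-identityʳ _) (nC1≡n (suc m)))))
  m*mCj≡[j+1]*mC[j+1]+j*mCj (suc m) (suc j) = begin
    suc m ℕ.* (suc m C suc j)
      ≡⟨ cong (suc m ℕ.*_) (nCk+nC[k+1]≡[n+1]C[k+1] m j) ⟨
    suc m ℕ.* (A ℕ.+ B)
      ≡⟨ expand m A B ⟩
    A ℕ.+ B ℕ.+ m ℕ.* A ℕ.+ m ℕ.* B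
      ≡⟨ cong₂ (λ x y → A ℕ.+ B ℕ.+ x ℕ.+ y)
           (m*mCj≡[j+1]*mC[j+1]+j*mCj m j) (m*mCj≡[j+1]*mC[j+1]+j*mCj m (suc j)) ⟩
    A ℕ.+ B ℕ.+ (suc j ℕ.* B ℕ.+ j ℕ.* A) ℕ.+ (suc (suc j) ℕ.* D ℕ.+ suc j ℕ.* B)
      ≡⟨ collect j A B D ⟩
    suc (suc j) ℕ.* (B ℕ.+ D) ℕ.+ suc j ℕ.* (A ℕ.+ B)
      ≡⟨ cong₂ (λ x y → suc (suc j) ℕ.* x ℕ.+ suc j ℕ.* y)
           (nCk+nC[k+1]≡[n+1]C[k+1] m (suc j)) (nCk+nC[k+1]≡[n+1]C[k+1] m j) ⟩
    suc (suc j) ℕ.* (suc m C suc (suc j)) ℕ.+ suc j ℕ.* (suc m C suc j) ∎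
    where
    open ≡-Reasoning
    A = m C j
    B = m C suc j
    D = m C suc (suc j)
    expand : ∀ m A B → suc m ℕ.* (A ℕ.+ B) ≡ A ℕ.+ B ℕ.+ m ℕ.* A ℕ.+ m ℕ.* B
    expand = solve-∀
    collect : ∀ j A B D → A ℕ.+ B ℕ.+ (suc j ℕ.* B ℕ.+ j ℕ.* A) ℕ.+ (suc (suc j) ℕ.* D ℕ.+ suc j ℕ.* B)
                        ≡ suc (suc j) ℕ.* (B ℕ.+ D) ℕ.+ suc j ℕ.* (A ℕ.+ B)
    collect = solve-∀

  m^k≡ΣS[k,j]j!mCj : ∀ m k → fromℕ (m ℕ.^ k) ≡ sumTo k (λ j → fromℕ (stirling2 k j ℕ.* j ! ℕ.* (m C j)))
  m^k≡ΣS[k,j]j!mCj m zero    = refl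
  m^k≡ΣS[k,j]j!mCj m (suc k) = begin
    fromℕ (m ℕ.* m ℕ.^ k)
      ≡⟨ fromℕ-* m (m ℕ.^ k) ⟩
    fromℕ m * fromℕ (m ℕ.^ k)
      ≡⟨ cong (fromℕ m *_) (m^k≡ΣS[k,j]j!mCj m k) ⟩
    fromℕ m * sumTo k (λ j → fromℕ (x j))
      ≡⟨ *-distribˡ-sumTo k (fromℕ m) (λ j → fromℕ (x j)) ⟩
    sumTo k (λ j → fromℕ m * fromℕ (x j))
      ≡⟨ sumTo-congʳ k (λ j → trans (sym (fromℕ-* m (x j))) (trans (cong fromℕ (absorb j)) (fromℕ-+ (a j) (b j)))) ⟩
    sumTo k (λ j → fromℕ (a j) + fromℕ (b j))
      ≡⟨ sumTo-+ k (λ j → fromℕ (a j)) (λ j → fromℕ (b j)) ⟩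
    sumTo k (λ j → fromℕ (a j)) + sumTo k (λ j → fromℕ (b j))
      ≡⟨ cong (sumTo k (λ j → fromℕ (a j)) +_) shift-b ⟩
    sumTo k (λ j → fromℕ (a j)) + sumTo k (λ j → fromℕ (b (suc j)))
      ≡⟨ sumTo-+ k (λ j → fromℕ (a j)) (λ j → fromℕ (b (suc j))) ⟨
    sumTo k (λ j → fromℕ (a j) + fromℕ (b (suc j)))
      ≡⟨ sumTo-congʳ k (λ j → trans (sym (fromℕ-+ (a j) (b (suc j)))) (cong fromℕ (pascal j))) ⟩
    sumTo k (λ j → fromℕ (y (suc j)))
      ≡⟨ sumTo-suc-vanishing k (λ j → fromℕ (y j)) refl ⟨
    sumTo (suc k) (λ j → fromℕ (y j)) ∎
    where
    open ≡-Reasoning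
    x y a b : ℕ → ℕ
    x j = stirling2 k j ℕ.* j ! ℕ.* (m C j)
    y j = stirling2 (suc k) j ℕ.* j ! ℕ.* (m C j)
    a j = stirling2 k j ℕ.* suc j ! ℕ.* (m C suc j)
    b j = j ℕ.* stirling2 k j ℕ.* j ! ℕ.* (m C j)
    absorb : ∀ j → m ℕ.* x j ≡ a j ℕ.+ b j
    absorb j = begin
      m ℕ.* (S ℕ.* j ! ℕ.* (m C j))                            ≡⟨ pull-m m S (j !) (m C j) ⟩
      S ℕ.* j ! ℕ.* (m ℕ.* (m C j))                            ≡⟨ cong (S ℕ.* j ! ℕ.*_) (m*mCj≡[j+1]*mC[j+1]+j*mCj m j) ⟩
      S ℕ.* j ! ℕ.* (suc j ℕ.* (m C suc j) ℕ.+ j ℕ.* (m C j))≡⟨ spread S (j !) j (m C suc j) (m C j) ⟩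
      a j ℕ.+ b j                                              ∎
      where
      S = stirling2 k j
      pull-m : ∀ m S F c → m ℕ.* (S ℕ.* F ℕ.* c) ≡ S ℕ.* F ℕ.* (m ℕ.* c)
      pull-m = solve-∀
      spread : ∀ S F j c′ c → S ℕ.* F ℕ.* (suc j ℕ.* c′ ℕ.+ j ℕ.* c)
                            ≡ S ℕ.* (suc j ℕ.* F) ℕ.* c′ ℕ.+ j ℕ.* S ℕ.* F ℕ.* c
      spread = solve-∀
    pascal : ∀ j → a j ℕ.+ b (suc j) ≡ y (suc j)
    pascal j = factor (stirling2 k j) (stirling2 k (suc j)) j (suc j !) (m C suc j)
      where
      factor : ∀ s t j F c → s ℕ.* F ℕ.* c ℕ.+ suc j ℕ.* t ℕ.* F ℕ.* c ≡ (s ℕ.+ suc j ℕ.* t) ℕ.* F ℕ.* c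
      factor = solve-∀
    shift-b : sumTo k (λ j → fromℕ (b j)) ≡ sumTo k (λ j → fromℕ (b (suc j)))
    shift-b = begin
      sumTo k (λ j → fromℕ (b j))                   ≡⟨ ℚP.+-identityʳ _ ⟨
      sumTo k (λ j → fromℕ (b j)) + 0ℚ              ≡⟨ cong (λ z → sumTo k (λ j → fromℕ (b j)) + fromℕ z) b[1+k]≡0 ⟨
      sumTo (suc k) (λ j → fromℕ (b j))             ≡⟨ sumTo-suc-vanishing k (λ j → fromℕ (b j)) refl ⟩
      sumTo k (λ j → fromℕ (b (suc j)))             ∎
      where
      b[1+k]≡0 : b (suc k) ≡ 0
      b[1+k]≡0 rewrite stirling2-vanishing {k} {suc k} ℕP.≤-refl | ℕP.*-zeroʳ (suc k) = refl

  -- Li₋₍ₖ₊₁₎(tanh(ct/2)); here and below k is one less than the order of the polylogarithm.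

  LiS-neg-binomial : ∀ k →
    LiS ℤ.-[1+ k ] ≗ sumS (suc k) (λ j → scale (fromℕ (stirling2 (suc k) j ℕ.* j !)) (binomialSeries j))
  LiS-neg-binomial k zero    = trans (m^k≡ΣS[k,j]j!mCj 0 (suc k))
    (sumTo-congʳ (suc k) (λ j → fromℕ-* (stirling2 (suc k) j ℕ.* j !) (0 C j)))
  LiS-neg-binomial k (suc m) = trans (m^k≡ΣS[k,j]j!mCj (suc m) (suc k))
    (sumTo-congʳ (suc k) (λ j → fromℕ-* (stirling2 (suc k) j ℕ.* j !) (suc m C j)))

  AS-∘S-odd : ∀ k {g} → reflect g ≗ ⊖ g → AS k ∘S g ≗ (LiS k ∘S g) ⊕ (⊖ reflect (LiS k ∘S g))
  AS-∘S-odd k {g} g-odd = begin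
    (LiS k ⊕ (⊖ reflect (LiS k))) ∘S g          ≈⟨ ∘S-distribʳ-⊕ g (LiS k) (⊖ reflect (LiS k)) ⟩
    (LiS k ∘S g) ⊕ ((⊖ reflect (LiS k)) ∘S g)   ≈⟨ ⊕-congˡ (LiS k ∘S g) (∘S-⊖ (reflect (LiS k)) g) ⟩
    (LiS k ∘S g) ⊕ (⊖ (reflect (LiS k) ∘S g))   ≈⟨ ⊕-congˡ (LiS k ∘S g) (⊖-cong reflect-Li∘g) ⟩
    (LiS k ∘S g) ⊕ (⊖ reflect (LiS k ∘S g))     ∎
    where
    open ≗-Reasoning
    reflect-Li∘g : reflect (LiS k) ∘S g ≗ reflect (LiS k ∘S g)
    reflect-Li∘g = begin
      reflect (LiS k) ∘S g    ≈⟨ reflect-∘Sʳ (LiS k) g ⟩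
      LiS k ∘S (⊖ g)          ≈⟨ ∘S-congˡ (LiS k) g-odd ⟨
      LiS k ∘S reflect g      ≈⟨ reflect-∘S (LiS k) g ⟨
      reflect (LiS k ∘S g)    ∎

  stirlingWeight : ℕ → ℕ → ℚ
  stirlingWeight k j = fromℕ (stirling2 (suc k) j ℕ.* j !) * invPow2 (suc j)

  LiOverTanh : ℚ → ℕ → Series
  LiOverTanh c k =
    sumS k (λ i → scale (stirlingWeight k (suc i)) (powS (expMinus1 c) i ⊛ expPlus1 (c + c)))

  invPow2≡qpow½ : ∀ m → invPow2 m ≡ qpow ½ m
  invPow2≡qpow½ zero    = refl
  invPow2≡qpow½ (suc m) = cong (_* ½) (invPow2≡qpow½ m)

  module _ (c : ℚ) where

    private
      E N D q : Series
      E = expS c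
      N = expMinus1 c
      D = expPlus1 c
      q = tanhHalf c

    one-minus-tanhHalf-⊛ : (𝟙 ⊕ (⊖ q)) ⊛ scale ½ D ≗ 𝟙
    one-minus-tanhHalf-⊛ n = begin
      ((𝟙 ⊕ (⊖ q)) ⊛ scale ½ D) n          ≡⟨ ⊛-scaleʳ ½ (𝟙 ⊕ (⊖ q)) D n ⟩
      ½ * ((𝟙 ⊕ (⊖ q)) ⊛ D) n              ≡⟨ cong (½ *_) (⊛-distribʳ-⊕ D 𝟙 (⊖ q) n) ⟩
      ½ * ((𝟙 ⊛ D) n + ((⊖ q) ⊛ D) n)      ≡⟨ cong₂ (λ x y → ½ * (x + y)) (⊛-identityˡ D n)
                                                (trans (⊛-negˡ q D n) (cong -_ (tanhHalf-⊛-expPlus1 c n))) ⟩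
      ½ * (D n + - N n)                    ≡⟨ solve 2 (λ e o → con ½ :* ((e :+ o) :+ :- (e :+ :- o)) := o) refl (E n) (𝟙 n) ⟩
      𝟙 n                                  ∎
      where open ≡-Reasoning

    binomialSeries-∘S-tanhHalf : ∀ j → binomialSeries j ∘S q ≗ scale (invPow2 (suc j)) (powS N j ⊛ D)
    binomialSeries-∘S-tanhHalf j = begin
      binomialSeries j ∘S q                                    ≈⟨ binomialSeries-∘S refl one-minus-tanhHalf-⊛ j ⟩
      powS q j ⊛ powS (scale ½ D) (suc j)                      ≈⟨ ⊛-congˡ (powS q j) (powS-scale ½ D (suc j)) ⟩
      powS q j ⊛ scale (qpow ½ (suc j)) (powS D j ⊛ D)         ≈⟨ ⊛-scaleʳ (qpow ½ (suc j)) (powS q j) (powS D j ⊛ D) ⟩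
      scale (qpow ½ (suc j)) (powS q j ⊛ (powS D j ⊛ D))       ≈⟨ (λ n → cong₂ _*_ (sym (invPow2≡qpow½ (suc j))) (qʲDʲ⁺¹ n)) ⟩
      scale (invPow2 (suc j)) (powS N j ⊛ D)                   ∎
      where
      open ≗-Reasoning
      qʲDʲ⁺¹ : powS q j ⊛ (powS D j ⊛ D) ≗ powS N j ⊛ D
      qʲDʲ⁺¹ = begin
        powS q j ⊛ (powS D j ⊛ D)     ≈⟨ ⊛-assoc (powS q j) (powS D j) D ⟨
        (powS q j ⊛ powS D j) ⊛ D     ≈⟨ ⊛-congʳ D (powS-⊛ q D j) ⟨
        powS (q ⊛ D) j ⊛ D            ≈⟨ ⊛-congʳ D (powS-cong j (tanhHalf-⊛-expPlus1 c)) ⟩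
        powS N j ⊛ D                  ∎

    LiS-∘S-tanhHalf : ∀ k → LiS ℤ.-[1+ k ] ∘S q ≗ sumS (suc k) (λ j → scale (stirlingWeight k j) (powS N j ⊛ D))
    LiS-∘S-tanhHalf k = begin
      LiS ℤ.-[1+ k ] ∘S q
        ≈⟨ ∘S-congʳ q (LiS-neg-binomial k) ⟩
      sumS (suc k) (λ j → scale (a j) (binomialSeries j)) ∘S q
        ≈⟨ ∘S-sumS (suc k) (λ j → scale (a j) (binomialSeries j)) q ⟩
      sumS (suc k) (λ j → scale (a j) (binomialSeries j) ∘S q)
        ≈⟨ sumS-cong (suc k) (λ j n → trans (∘S-scale (a j) (binomialSeries j) q n)
             (trans (cong (a j *_) (binomialSeries-∘S-tanhHalf j n)) (sym (ℚP.*-assoc (a j) _ _)))) ⟩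
      sumS (suc k) (λ j → scale (stirlingWeight k j) (powS N j ⊛ D)) ∎
      where
      open ≗-Reasoning
      a : ℕ → ℚ
      a j = fromℕ (stirling2 (suc k) j ℕ.* j !)

    expMinus1-⊛-expPlus1 : N ⊛ D ≗ expMinus1 (c + c)
    expMinus1-⊛-expPlus1 n = begin
      ((E ⊕ (⊖ 𝟙)) ⊛ D) n                  ≡⟨ ⊛-distribʳ-⊕ D E (⊖ 𝟙) n ⟩
      (E ⊛ D) n + ((⊖ 𝟙) ⊛ D) n            ≡⟨ cong₂ _+_ (⊛-distribˡ-⊕ E E 𝟙 n) (⊛-negˡ 𝟙 D n) ⟩
      ((E ⊛ E) n + (E ⊛ 𝟙) n) + - (𝟙 ⊛ D) n
                                           ≡⟨ cong₂ (λ x y → ((E ⊛ E) n + x) + - y) (⊛-identityʳ E n) (⊛-identityˡ D n) ⟩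
      ((E ⊛ E) n + E n) + - (E n + 𝟙 n)
                                           ≡⟨ solve 3 (λ a e o → (a :+ e) :+ :- (e :+ o) := a :+ :- o) refl ((E ⊛ E) n) (E n) (𝟙 n) ⟩
      (E ⊛ E) n + - 𝟙 n                    ≡⟨ cong (_+ - 𝟙 n) (expS-+ c c n) ⟩
      expMinus1 (c + c) n                  ∎
      where open ≡-Reasoning

    expPlus1-double : expPlus1 (c + c) ≗ (N ⊛ N) ⊕ (scale two N ⊕ scale two 𝟙)
    expPlus1-double n = begin
      expS (c + c) n + 𝟙 n                       ≡⟨ cong (_+ 𝟙 n) (expS-+ c c n) ⟨
      (E ⊛ E) n + 𝟙 n                            ≡⟨ cong (_+ 𝟙 n) (⊛-cong E≈𝟙+N E≈𝟙+N n) ⟩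
      ((𝟙 ⊕ N) ⊛ (𝟙 ⊕ N)) n + 𝟙 n                ≡⟨ cong (_+ 𝟙 n) square ⟩
      (𝟙 n + N n) + (N n + (N ⊛ N) n) + 𝟙 n      ≡⟨ solve 3 (λ o x y → ((o :+ x) :+ (x :+ y)) :+ o
                                                             := y :+ ((con 1ℚ :+ con 1ℚ) :* x :+ (con 1ℚ :+ con 1ℚ) :* o))
                                                      refl (𝟙 n) (N n) ((N ⊛ N) n) ⟩
      (N ⊛ N) n + (two * N n + two * 𝟙 n)        ∎
      where
      open ≡-Reasoning
      E≈𝟙+N : E ≗ 𝟙 ⊕ N
      E≈𝟙+N n = solve 2 (λ e o → e := o :+ (e :+ :- o)) refl (E n) (𝟙 n)
      square : ((𝟙 ⊕ N) ⊛ (𝟙 ⊕ N)) n ≡ (𝟙 n + N n) + (N n + (N ⊛ N) n)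
      square = trans (⊛-distribʳ-⊕ (𝟙 ⊕ N) 𝟙 N n) (cong₂ _+_ (⊛-identityˡ (𝟙 ⊕ N) n)
                 (trans (⊛-distribˡ-⊕ N 𝟙 N n) (cong (_+ (N ⊛ N) n) (⊛-identityʳ N n))))

    LiS-∘S-tanhHalf≗tanhHalf⊛LiOverTanh : ∀ k → LiS ℤ.-[1+ k ] ∘S q ≗ tanhHalf (c + c) ⊛ LiOverTanh c k
    LiS-∘S-tanhHalf≗tanhHalf⊛LiOverTanh k = begin
      LiS ℤ.-[1+ k ] ∘S q
        ≈⟨ LiS-∘S-tanhHalf k ⟩
      sumS (suc k) (λ j → scale (w j) (powS N j ⊛ D))
        ≈⟨ (λ n → sumTo-suc-vanishing k (λ j → w j * (powS N j ⊛ D) n) (ℚP.*-zeroˡ ((𝟙 ⊛ D) n))) ⟩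
      sumS k (λ i → scale (w (suc i)) (powS N (suc i) ⊛ D))
        ≈⟨ sumS-cong k (λ i n → cong (w (suc i) *_) (factor i n)) ⟨
      sumS k (λ i → scale (w (suc i)) (T ⊛ (powS N i ⊛ Z)))
        ≈⟨ sumS-cong k (λ i → ⊛-scaleʳ (w (suc i)) T (powS N i ⊛ Z)) ⟨
      sumS k (λ i → T ⊛ scale (w (suc i)) (powS N i ⊛ Z))
        ≈⟨ ⊛-sumS T k (λ i → scale (w (suc i)) (powS N i ⊛ Z)) ⟨
      T ⊛ LiOverTanh c k ∎
      where
      open ≗-Reasoning
      w = stirlingWeight k
      T = tanhHalf (c + c)
      Z = expPlus1 (c + c)
      factor : ∀ i → T ⊛ (powS N i ⊛ Z) ≗ powS N (suc i) ⊛ D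
      factor i = begin
        T ⊛ (powS N i ⊛ Z)      ≈⟨ ⊛-assoc T (powS N i) Z ⟨
        (T ⊛ powS N i) ⊛ Z      ≈⟨ ⊛-congʳ Z (⊛-comm T (powS N i)) ⟩
        (powS N i ⊛ T) ⊛ Z      ≈⟨ ⊛-assoc (powS N i) T Z ⟩
        powS N i ⊛ (T ⊛ Z)      ≈⟨ ⊛-congˡ (powS N i) (tanhHalf-⊛-expPlus1 (c + c)) ⟩
        powS N i ⊛ expMinus1 (c + c)  ≈⟨ ⊛-congˡ (powS N i) expMinus1-⊛-expPlus1 ⟨
        powS N i ⊛ (N ⊛ D)      ≈⟨ ⊛-assoc (powS N i) N D ⟨
        powS N (suc i) ⊛ D      ∎

    AS-∘S-tanhHalf : ∀ k → AS ℤ.-[1+ k ] ∘S q ≗ tanhHalf (c + c) ⊛ (LiOverTanh c k ⊕ reflect (LiOverTanh c k))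
    AS-∘S-tanhHalf k = begin
      AS ℤ.-[1+ k ] ∘S q                          ≈⟨ AS-∘S-odd ℤ.-[1+ k ] (tanhHalf-odd c) ⟩
      L ⊕ (⊖ reflect L)                           ≈⟨ ⊕-cong L≈T⊛H (⊖-cong reflect-L) ⟩
      (T ⊛ H) ⊕ (⊖ (⊖ (T ⊛ reflect H)))          ≈⟨ ⊕-congˡ (T ⊛ H) (λ n → solve 1 (λ x → :- (:- x) := x) refl ((T ⊛ reflect H) n)) ⟩
      (T ⊛ H) ⊕ (T ⊛ reflect H)                   ≈⟨ ⊛-distribˡ-⊕ T H (reflect H) ⟨
      T ⊛ (H ⊕ reflect H)                         ∎
      where
      open ≗-Reasoning
      L = LiS ℤ.-[1+ k ] ∘S q
      T = tanhHalf (c + c)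
      H = LiOverTanh c k
      L≈T⊛H : L ≗ T ⊛ H
      L≈T⊛H = LiS-∘S-tanhHalf≗tanhHalf⊛LiOverTanh k
      reflect-L : reflect L ≗ ⊖ (T ⊛ reflect H)
      reflect-L = begin
        reflect L                     ≈⟨ reflect-cong L≈T⊛H ⟩
        reflect (T ⊛ H)               ≈⟨ reflect-⊛ T H ⟩
        reflect T ⊛ reflect H         ≈⟨ ⊛-congʳ (reflect H) (tanhHalf-odd (c + c)) ⟩
        (⊖ T) ⊛ reflect H             ≈⟨ ⊛-negˡ T (reflect H) ⟩
        ⊖ (T ⊛ reflect H)             ∎

  polycotD-neg : ∀ k N →
    polycotD ℤ.-[1+ k ] N ≡ fromℕ (N !) * (LiOverTanh 1ℚ k N + sgn N * LiOverTanh 1ℚ k N)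
  polycotD-neg k N = cong (fromℕ (N !) *_) (quotient N)
    where
    open ≗-Reasoning
    H  = LiOverTanh 1ℚ k
    T  = tanhHalf two
    T′ = divT T
    T′₀≢0 : T′ 0 ≢ 0ℚ
    T′₀≢0 ()
    quotient : divT (AS ℤ.-[1+ k ] ∘S tanhHalf 1ℚ) ⊛ invS T′ ≗ H ⊕ reflect H
    quotient = begin
      divT (AS ℤ.-[1+ k ] ∘S tanhHalf 1ℚ) ⊛ invS T′      ≈⟨ ⊛-congʳ (invS T′) (λ n → AS-∘S-tanhHalf 1ℚ k (suc n)) ⟩
      divT (T ⊛ (H ⊕ reflect H)) ⊛ invS T′              ≈⟨ ⊛-congʳ (invS T′) (divT-⊛ T (H ⊕ reflect H) refl) ⟩
      (T′ ⊛ (H ⊕ reflect H)) ⊛ invS T′                  ≈⟨ ⊛-rightComm T′ (H ⊕ reflect H) (invS T′) ⟩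
      (T′ ⊛ invS T′) ⊛ (H ⊕ reflect H)                  ≈⟨ ⊛-congʳ (H ⊕ reflect H) (invS-inverseʳ T′ T′₀≢0) ⟩
      𝟙 ⊛ (H ⊕ reflect H)                               ≈⟨ ⊛-identityˡ (H ⊕ reflect H) ⟩
      H ⊕ reflect H                                     ∎

  stirlingCombination : ℕ → ℕ → ℕ
  stirlingCombination i N =
    suc (suc i) ! ℕ.* stirling2 N (suc (suc i)) ℕ.+ 2 ℕ.* (suc i ! ℕ.* stirling2 N (suc i) ℕ.+ i ! ℕ.* stirling2 N i)

  expMinus1^i⊛expPlus1-coefficient : ∀ i N →
    fromℕ (N !) * (powS (expMinus1 1ℚ) i ⊛ expPlus1 two) N ≡ fromℕ (stirlingCombination i N)
  expMinus1^i⊛expPlus1-coefficient i N = begin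
    F * (powS u i ⊛ expPlus1 two) N
      ≡⟨ cong (F *_) (⊛-congˡ (powS u i) (expPlus1-double 1ℚ) N) ⟩
    F * (powS u i ⊛ ((u ⊛ u) ⊕ (scale two u ⊕ scale two 𝟙))) N
      ≡⟨ cong (F *_) expand ⟩
    F * (powS u (suc (suc i)) N + (two * powS u (suc i) N + two * powS u i N))
      ≡⟨ solve 4 (λ f a b c → f :* (a :+ ((con 1ℚ :+ con 1ℚ) :* b :+ (con 1ℚ :+ con 1ℚ) :* c))
                            := f :* a :+ (con 1ℚ :+ con 1ℚ) :* (f :* b :+ f :* c)) refl
           F (powS u (suc (suc i)) N) (powS u (suc i) N) (powS u i N) ⟩
    F * powS u (suc (suc i)) N + two * (F * powS u (suc i) N + F * powS u i N)
      ≡⟨ cong₂ (λ a b → a + two * b) (stirling2-coefficient N (suc (suc i)))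
           (cong₂ _+_ (stirling2-coefficient N (suc i)) (stirling2-coefficient N i)) ⟩
    fromℕ a + fromℕ 2 * (fromℕ b + fromℕ c)
      ≡⟨ cong (λ x → fromℕ a + fromℕ 2 * x) (fromℕ-+ b c) ⟨
    fromℕ a + fromℕ 2 * fromℕ (b ℕ.+ c)
      ≡⟨ cong (fromℕ a +_) (fromℕ-* 2 (b ℕ.+ c)) ⟨
    fromℕ a + fromℕ (2 ℕ.* (b ℕ.+ c))
      ≡⟨ fromℕ-+ a (2 ℕ.* (b ℕ.+ c)) ⟨
    fromℕ (stirlingCombination i N) ∎
    where
    open ≡-Reasoning
    u = expMinus1 1ℚ
    F = fromℕ (N !)
    a = suc (suc i) ! ℕ.* stirling2 N (suc (suc i))
    b = suc i ! ℕ.* stirling2 N (suc i)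
    c = i ! ℕ.* stirling2 N i
    expand : (powS u i ⊛ ((u ⊛ u) ⊕ (scale two u ⊕ scale two 𝟙))) N
             ≡ powS u (suc (suc i)) N + (two * powS u (suc i) N + two * powS u i N)
    expand = begin
      (powS u i ⊛ ((u ⊛ u) ⊕ (scale two u ⊕ scale two 𝟙))) N
        ≡⟨ ⊛-distribˡ-⊕ (powS u i) (u ⊛ u) (scale two u ⊕ scale two 𝟙) N ⟩
      (powS u i ⊛ (u ⊛ u)) N + (powS u i ⊛ (scale two u ⊕ scale two 𝟙)) N
        ≡⟨ cong₂ _+_ (sym (⊛-assoc (powS u i) u u N)) (⊛-distribˡ-⊕ (powS u i) (scale two u) (scale two 𝟙) N) ⟩
      powS u (suc (suc i)) N + ((powS u i ⊛ scale two u) N + (powS u i ⊛ scale two 𝟙) N)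
        ≡⟨ cong₂ (λ x y → powS u (suc (suc i)) N + (x + y)) (⊛-scaleʳ two (powS u i) u N)
             (trans (⊛-scaleʳ two (powS u i) 𝟙 N) (cong (two *_) (⊛-identityʳ (powS u i) N))) ⟩
      powS u (suc (suc i)) N + (two * powS u (suc i) N + two * powS u i N) ∎

  LiOverTanh-coefficient : ∀ k N →
    fromℕ (N !) * LiOverTanh 1ℚ k N ≡ sumTo k (λ i → stirlingWeight k (suc i) * fromℕ (stirlingCombination i N))
  LiOverTanh-coefficient k N = begin
    F * sumTo k (λ i → w i * X i)          ≡⟨ *-distribˡ-sumTo k F (λ i → w i * X i) ⟩
    sumTo k (λ i → F * (w i * X i))        ≡⟨ sumTo-congʳ k (λ i → solve 3 (λ f w x → f :* (w :* x) := w :* (f :* x)) refl F (w i) (X i)) ⟩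
    sumTo k (λ i → w i * (F * X i))        ≡⟨ sumTo-congʳ k (λ i → cong (w i *_) (expMinus1^i⊛expPlus1-coefficient i N)) ⟩
    sumTo k (λ i → w i * fromℕ (stirlingCombination i N)) ∎
    where
    open ≡-Reasoning
    F = fromℕ (N !)
    w = λ i → stirlingWeight k (suc i)
    X = λ i → (powS (expMinus1 1ℚ) i ⊛ expPlus1 two) N

  polycotD-neg-even : ∀ n k → polycotD ℤ.-[1+ k ] (2 ℕ.* n)
    ≡ sumTo k (λ j → fromℕ (stirling2 (suc k) (suc j) ℕ.* suc j ! ℕ.* stirlingCombination j (2 ℕ.* n)) * invPow2 (suc j))
  polycotD-neg-even n k = begin
    polycotD ℤ.-[1+ k ] N                        ≡⟨ polycotD-neg k N ⟩
    F * (H N + sgn N * H N)                      ≡⟨ cong (λ s → F * (H N + s * H N)) (sgn-even n) ⟩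
    F * (H N + 1ℚ * H N)                         ≡⟨ solve 2 (λ f h → f :* (h :+ con 1ℚ :* h) := (con 1ℚ :+ con 1ℚ) :* (f :* h)) refl F (H N) ⟩
    two * (F * H N)                              ≡⟨ cong (two *_) (LiOverTanh-coefficient k N) ⟩
    two * sumTo k (λ j → w j * fromℕ (z j))      ≡⟨ *-distribˡ-sumTo k two (λ j → w j * fromℕ (z j)) ⟩
    sumTo k (λ j → two * (w j * fromℕ (z j)))    ≡⟨ sumTo-congʳ k halve ⟩
    sumTo k (λ j → fromℕ (s j ℕ.* z j) * invPow2 (suc j)) ∎
    where
    open ≡-Reasoning
    N = 2 ℕ.* n
    F = fromℕ (N !)
    H = LiOverTanh 1ℚ k
    w = λ j → stirlingWeight k (suc j)
    s = λ j → stirling2 (suc k) (suc j) ℕ.* suc j !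
    z = λ j → stirlingCombination j N
    halve : ∀ j → two * (w j * fromℕ (z j)) ≡ fromℕ (s j ℕ.* z j) * invPow2 (suc j)
    halve j = begin
      two * ((fromℕ (s j) * (invPow2 (suc j) * ½)) * fromℕ (z j))
        ≡⟨ solve 3 (λ a p b → (con 1ℚ :+ con 1ℚ) :* ((a :* (p :* con ½)) :* b) := (a :* b) :* p) refl
             (fromℕ (s j)) (invPow2 (suc j)) (fromℕ (z j)) ⟩
      (fromℕ (s j) * fromℕ (z j)) * invPow2 (suc j)
        ≡⟨ cong (_* invPow2 (suc j)) (fromℕ-* (s j) (z j)) ⟨
      fromℕ (s j ℕ.* z j) * invPow2 (suc j) ∎

  summand : ℕ → ℕ → ℕ → ℕ → ℚ
  summand x s κ j = fromℕ (x ℕ.* s ℕ.* κ) * invPow2 (suc j)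

  summand-vanishing : ∀ x {s} κ j → s ≡ 0 → summand x s κ j ≡ 0ℚ
  summand-vanishing x κ j refl =
    trans (cong (λ y → fromℕ (y ℕ.* κ) * invPow2 (suc j)) (ℕP.*-zeroʳ x)) (ℚP.*-zeroˡ (invPow2 (suc j)))

  summand-split : ∀ N K j →
    fromℕ (stirling2 K (suc j) ℕ.* suc j ! ℕ.* stirlingCombination j N) * invPow2 (suc j)
      ≡ summand (j ! ℕ.* suc j !) (stirling2 N j) (stirling2 K (suc j)) j
      + summand (suc j ! ℕ.* suc j !) (stirling2 N (suc j)) (stirling2 K (suc j)) j
      + summand (suc j ! ℕ.* suc (suc j) !) (stirling2 N (suc (suc j))) (stirling2 K (suc j)) j
      + summand (j ! ℕ.* suc j !) (stirling2 (suc N) (suc j)) (stirling2 K (suc j)) j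
  summand-split N K j = begin
    fromℕ (κ ℕ.* suc j ! ℕ.* stirlingCombination j N) * I
      ≡⟨ cong (λ x → fromℕ x * I) (regroup j (j !) S₀ S₁ S₂ κ) ⟨
    fromℕ (a₁ ℕ.+ a₂ ℕ.+ a₃ ℕ.+ a₄) * I
      ≡⟨ cong (_* I) (trans (fromℕ-+ (a₁ ℕ.+ a₂ ℕ.+ a₃) a₄) (cong (_+ fromℕ a₄)
           (trans (fromℕ-+ (a₁ ℕ.+ a₂) a₃) (cong (_+ fromℕ a₃) (fromℕ-+ a₁ a₂))))) ⟩
    (fromℕ a₁ + fromℕ a₂ + fromℕ a₃ + fromℕ a₄) * I
      ≡⟨ solve 5 (λ a b c d i → (a :+ b :+ c :+ d) :* i := a :* i :+ b :* i :+ c :* i :+ d :* i) refl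
           (fromℕ a₁) (fromℕ a₂) (fromℕ a₃) (fromℕ a₄) I ⟩
    fromℕ a₁ * I + fromℕ a₂ * I + fromℕ a₃ * I + fromℕ a₄ * I ∎
    where
    open ≡-Reasoning
    I = invPow2 (suc j)
    κ = stirling2 K (suc j)
    S₀ = stirling2 N j
    S₁ = stirling2 N (suc j)
    S₂ = stirling2 N (suc (suc j))
    a₁ = j ! ℕ.* suc j ! ℕ.* S₀ ℕ.* κ
    a₂ = suc j ! ℕ.* suc j ! ℕ.* S₁ ℕ.* κ
    a₃ = suc j ! ℕ.* suc (suc j) ! ℕ.* S₂ ℕ.* κ
    a₄ = j ! ℕ.* suc j ! ℕ.* stirling2 (suc N) (suc j) ℕ.* κ
    regroup : ∀ j F S₀ S₁ S₂ κ →
      F ℕ.* (suc j ℕ.* F) ℕ.* S₀ ℕ.* κ ℕ.+ (suc j ℕ.* F) ℕ.* (suc j ℕ.* F) ℕ.* S₁ ℕ.* κ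
      ℕ.+ (suc j ℕ.* F) ℕ.* (suc (suc j) ℕ.* (suc j ℕ.* F)) ℕ.* S₂ ℕ.* κ
      ℕ.+ F ℕ.* (suc j ℕ.* F) ℕ.* (S₀ ℕ.+ suc j ℕ.* S₁) ℕ.* κ
      ≡ κ ℕ.* (suc j ℕ.* F) ℕ.* (suc (suc j) ℕ.* (suc j ℕ.* F) ℕ.* S₂ ℕ.+ 2 ℕ.* (suc j ℕ.* F ℕ.* S₁ ℕ.+ F ℕ.* S₀))
    regroup = solve-∀

open Polycotangent
open import Defs
open import Data.Nat using (ℕ; suc; _*_; _∸_; _⊓_; _!; _≥_)
open import Data.Integer using (+_; -_)
open import Data.Rational using (ℚ; _+_) renaming (_*_ to _*ℚ_)
open import Relation.Binary.PropositionalEquality using (_≡_; cong₂; module ≡-Reasoning)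
open import Data.Nat.Properties using (m<n⇒m<1+n)
open import Data.Nat.Base using (s≤s)

proposition3p2 : (n k : ℕ) → n ≥ 1 → k ≥ 1 →
  polycotD (- (+ k)) (2 * n) ≡
    sumTo ((2 * n) ⊓ (k ∸ 1)) (λ j →
      fromℕ ((j !) * (suc j !) * stirling2 (2 * n) j * stirling2 k (suc j))
        *ℚ invPow2 (suc j))
    + sumTo ((2 * n ∸ 1) ⊓ (k ∸ 1)) (λ j →
      fromℕ ((suc j !) * (suc j !) * stirling2 (2 * n) (suc j) * stirling2 k (suc j))
        *ℚ invPow2 (suc j))
    + sumTo ((2 * n ∸ 1) ⊓ (k ∸ 1)) (λ j →
      fromℕ ((suc j !) * (suc (suc j) !) * stirling2 (2 * n) (suc (suc j)) * stirling2 k (suc j))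
        *ℚ invPow2 (suc j))
    + sumTo ((2 * n) ⊓ (k ∸ 1)) (λ j →
      fromℕ ((j !) * (suc j !) * stirling2 (suc (2 * n)) (suc j) * stirling2 k (suc j))
        *ℚ invPow2 (suc j))
proposition3p2 n 0       _ ()
proposition3p2 n (suc k) _ _ = begin
  polycotD (- (+ suc k)) N
    ≡⟨ polycotD-neg-even n k ⟩
  sumTo k (λ j → fromℕ (κ j * suc j ! * stirlingCombination j N) *ℚ invPow2 (suc j))
    ≡⟨ sumTo-congʳ k (summand-split N (suc k)) ⟩
  sumTo k (λ j → s₁ j + s₂ j + s₃ j + s₄ j)
    ≡⟨ sumTo-+₄ k s₁ s₂ s₃ s₄ ⟩
  sumTo k s₁ + sumTo k s₂ + sumTo k s₃ + sumTo k s₄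
    ≡⟨ cong₂ _+_ (cong₂ _+_ (cong₂ _+_ truncate₁ truncate₂) truncate₃) truncate₄ ⟨
  sumTo (N ⊓ k) s₁ + sumTo ((N ∸ 1) ⊓ k) s₂ + sumTo ((N ∸ 1) ⊓ k) s₃ + sumTo (N ⊓ k) s₄ ∎
  where
  open ≡-Reasoning
  N : ℕ
  N = 2 * n
  κ : ℕ → ℕ
  κ j = stirling2 (suc k) (suc j)
  s₁ s₂ s₃ s₄ : ℕ → ℚ
  s₁ j = summand (j ! * suc j !) (stirling2 N j) (κ j) j
  s₂ j = summand (suc j ! * suc j !) (stirling2 N (suc j)) (κ j) j
  s₃ j = summand (suc j ! * suc (suc j) !) (stirling2 N (suc (suc j))) (κ j) j
  s₄ j = summand (j ! * suc j !) (stirling2 (suc N) (suc j)) (κ j) j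
  truncate₁ : sumTo (N ⊓ k) s₁ ≡ sumTo k s₁
  truncate₁ = sumTo-⊓ N k s₁ (λ j N<j → summand-vanishing (j ! * suc j !) (κ j) j (stirling2-vanishing N<j))
  truncate₂ : sumTo ((N ∸ 1) ⊓ k) s₂ ≡ sumTo k s₂
  truncate₂ = sumTo-⊓ (N ∸ 1) k s₂ (λ j N∸1<j →
    summand-vanishing (suc j ! * suc j !) (κ j) j (stirling2-vanishing (m∸1<n⇒m<1+n N N∸1<j)))
  truncate₃ : sumTo ((N ∸ 1) ⊓ k) s₃ ≡ sumTo k s₃
  truncate₃ = sumTo-⊓ (N ∸ 1) k s₃ (λ j N∸1<j →
    summand-vanishing (suc j ! * suc (suc j) !) (κ j) j (stirling2-vanishing (m<n⇒m<1+n (m∸1<n⇒m<1+n N N∸1<j))))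
  truncate₄ : sumTo (N ⊓ k) s₄ ≡ sumTo k s₄
  truncate₄ = sumTo-⊓ N k s₄ (λ j N<j → summand-vanishing (j ! * suc j !) (κ j) j (stirling2-vanishing (s≤s N<j)))
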